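{- Let $\mathbf G=(\{0,1\},\leftarrow)$, where $\leftarrow$ is the converse implication, $x\leftarrow y:=y\rightarrow x$. Then $s^{\mathrm{ac}}_n(\mathbf G)=n^{n-1}$ and $s_n(\mathbf G)=C_{n-1}$ for all $n\ge1$.
   Context: The implication $\rightarrow$ on $\{0,1\}$ is defined by $x\rightarrow y=0$ if $x=1$ and $y=0$, and $x\rightarrow y=1$ otherwise. For $X_n=\{x_1,\dots,x_n\}$, groupoid terms are built recursively from variables by $(s,t)\mapsto(st)$; a full linear term over $X_n$ is a term in which each variable occurs exactly once, and a bracketing is a full linear term with variables in order $x_1,\dots,x_n$ from left to right. $s^{\mathrm{ac}}_n(\mathbf G)$ (resp. $s_n(\mathbf G)$) is the number of distinct $n$-ary term operations on $\mathbf G$ induced by full linear terms (resp. bracketings) over $X_n$. $C_m=\frac{1}{m+1}\binom{2m}{m}$. -}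

module Defs where

open import Data.Nat using (ℕ; zero; suc; _/_)
open import Data.Nat.Combinatorics using (_C_)
open import Data.Nat.Base using (_*_)
open import Data.Bool using (Bool; true; false)
open import Data.Fin using (Fin)
open import Data.List using (List; []; _∷_; [_]; _++_)
open import Data.List using (allFin)
open import Data.List.Relation.Binary.Permutation.Propositional using (_↭_)
open import Data.Product using (Σ; ∃; _×_)
open import Relation.Binary.PropositionalEquality using (_≡_)

-- Implication on {0,1} = Bool (false = 0, true = 1)
_⇒_ : Bool → Bool → Bool
true ⇒ false = false
_    ⇒ _     = true

_⇐_ : Bool → Bool → Bool
x ⇐ y = y ⇒ x

data Term (n : ℕ) : Set where
  var : Fin n → Term n
  _·_ : Term n → Term n → Term n

leaves : ∀ {n} → Term n → List (Fin n)
leaves (var i) = [ i ]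
leaves (s · t) = leaves s ++ leaves t

FullLinear : ∀ {n} → Term n → Set
FullLinear {n} t = leaves t ↭ allFin n

Bracketing : ∀ {n} → Term n → Set
Bracketing {n} t = leaves t ≡ allFin n

⟦_⟧ : ∀ {A : Set} {n} → Term n → (A → A → A) → (Fin n → A) → A
⟦ var i ⟧ op ρ = ρ i
⟦ s · t ⟧ op ρ = op (⟦ s ⟧ op ρ) (⟦ t ⟧ op ρ)

SameOp : ∀ {A : Set} {n} → (A → A → A) → Term n → Term n → Set
SameOp {A} {n} op s t = (ρ : Fin n → A) → ⟦ s ⟧ op ρ ≡ ⟦ t ⟧ op ρ

NumOps : ∀ {A : Set} {n} → (A → A → A) → (Term n → Set) → ℕ → Set
NumOps {A} {n} op P k =
  Σ (Fin k → Term n) λ e →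
    ((i : Fin k) → P (e i)) ×
    ((i j : Fin k) → SameOp op (e i) (e j) → i ≡ j) ×
    ((t : Term n) → P t → ∃ λ i → SameOp op (e i) t)

-- s^ac_n and s_n as predicates "= k"
sac : ∀ {A : Set} → (A → A → A) → ℕ → ℕ → Set
sac op n k = NumOps {n = n} op FullLinear k

sbr : ∀ {A : Set} → (A → A → A) → ℕ → ℕ → Set
sbr op n k = NumOps {n = n} op Bracketing k

catalan : ℕ → ℕ
catalan m = ((2 * m) C m) / suc m

{-# OPTIONS --safe #-}

-- Under x ⇐ y = y → x, a linear term x t₁ ⋯ tₖ computes x ∨ ¬t₁ ∨ ⋯ ∨ ¬tₖ, so it is a rooted
-- tree on its variables, and its term operation determines that tree: ℓ is a leaf with parent p
-- exactly when raising ℓ and p to 1 from ℓ = 0 never changes the value. Repeatedly removing the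
-- first leaf and recording its parent thus computes, from the operation alone, a Prüfer code in
-- Fin n ^ (n ∸ 1), and decoding inverts it: full linear terms induce n^(n-1) operations.
-- A bracketing s · u is recovered from its operation as well: making the head of u true exposes s,
-- falsifying s exposes u, and a split of the same leaf word at another place is refuted by a
-- single assignment. So bracketings induce C_{n-1} operations, counted by the ballot recurrence.

module Submission where

open import Defs
open import Level using (0ℓ)
open import Data.Empty using (⊥; ⊥-elim)
open import Data.Product using (∃; ∃₂; _×_; _,_; proj₁; proj₂; uncurry)
open import Data.Sum using (_⊎_; inj₁; inj₂; [_,_]; [_,_]′)
open import Data.Bool using (Bool; true; false; if_then_else_)
open import Data.Bool.Properties using () renaming (_≟_ to _≟ᵇ_)
open import Data.Maybe using (Maybe; just; nothing)
open import Data.Nat using (ℕ; zero; suc; _+_; _*_; _<_; _≤_; s≤s; _^_; _∸_; _/_)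
open import Data.Nat.Properties
  using ( suc-injective; ≤-refl; ≤-trans; ≤-pred; <-cmp; m≤m+n; m≤n+m; n≤1+n
        ; +-assoc; +-comm; +-suc; +-identityʳ; +-cancelˡ-≡; +-cancelʳ-≡; +-∸-assoc; m+n∸n≡m
        ; *-comm; *-zeroʳ; *-identityʳ; *-distribˡ-+; *-distribʳ-+ )
open import Data.Nat.DivMod using (m*n/n≡m)
open import Data.Nat.Combinatorics using (_C_; nC1≡n; nCk≡nC[n∸k]; nCk+nC[k+1]≡[n+1]C[k+1])
open import Data.Nat.ListAction using (sum)
open import Data.Nat.Solver using (module +-*-Solver)
open +-*-Solver using (solve; _:+_; _:*_; _:=_; con)
open import Data.Fin using (Fin; zero; suc; remQuot; combine; splitAt; join)
open import Data.Fin.Properties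
  using (_≟_; any?; remQuot-combine; combine-remQuot; join-splitAt; splitAt-join)
open import Data.Vec.Functional using (updateAt) renaming (_∷_ to _◂_; tail to tailᵥ)
open import Data.Vec.Functional.Properties using (updateAt-updates; updateAt-minimal)
open import Data.List using (List; []; _∷_; _++_; length; map; concatMap; filter; find; allFin)
open import Data.List.Properties
  using ( filter-all; filter-notAll; ∷-injective; ∷-injectiveˡ; ∷-injectiveʳ
        ; length-tabulate; length-++; length-map; ++-assoc; ++-identityʳ )
open import Data.List.Relation.Unary.Any as Any using (here; there)
open import Data.List.Relation.Unary.All as All using (All; [])
import Data.List.Relation.Unary.All.Properties as Allₚ
open import Data.List.Relation.Unary.AllPairs using ([]; _∷_)
open import Data.List.Relation.Unary.Unique.Propositional using (Unique)
import Data.List.Relation.Unary.Unique.Propositional.Properties as Unique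
open import Data.List.Membership.Propositional using (_∈_; _∉_)
open import Data.List.Membership.Propositional.Properties
  using (∈-filter⁺; ∈-filter⁻; ∈-allFin; ∈-++⁺ˡ; ∈-++⁺ʳ; ∈-++⁻)
open import Data.List.Membership.Propositional.Properties.WithK using (unique∧set⇒bag)
open import Data.List.Relation.Binary.BagAndSetEquality using (∼bag⇒↭)
open import Data.List.Relation.Binary.Permutation.Propositional using (↭-sym; ↭⇒↭ₛ)
open import Data.List.Relation.Binary.Permutation.Propositional.Properties using (∈-resp-↭)
open import Data.List.Relation.Binary.Permutation.Setoid.Properties using (Unique-resp-↭)
open import Function using (id; const; _∘_; case_of_)
open import Function.Bundles using (_⇔_; mk⇔; Equivalence)
open import Relation.Nullary using (¬_; Dec; yes; no; does; ¬?)
open import Relation.Nullary.Decidable using (does-⇔; map′; _×-dec_; _→-dec_; decidable-stable)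
open import Relation.Unary using (Pred; Decidable)
open import Relation.Binary.Definitions using (tri<; tri≈; tri>)
open import Relation.Binary.PropositionalEquality
open import Relation.Binary.PropositionalEquality.Properties using (setoid)

private variable
  n : ℕ

Assignment : ℕ → Set
Assignment n = Fin n → Bool

eval : Term n → Assignment n → Bool
eval t = ⟦ t ⟧ _⇐_

_[_≔_] : Assignment n → Fin n → Bool → Assignment n
ρ [ y ≔ b ] = updateAt ρ y (const b)

≔-same : (ρ : Assignment n) (y : Fin n) {b : Bool} → (ρ [ y ≔ b ]) y ≡ b
≔-same ρ y = updateAt-updates y ρ

≔-other : (ρ : Assignment n) {x y : Fin n} {b : Bool} → x ≢ y → (ρ [ y ≔ b ]) x ≡ ρ x
≔-other ρ {x} {y} = updateAt-minimal x y ρ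

≔-cong : {ρ σ : Assignment n} (y : Fin n) {b : Bool} {x : Fin n} →
         ρ x ≡ σ x → (ρ [ y ≔ b ]) x ≡ (σ [ y ≔ b ]) x
≔-cong {ρ = ρ} {σ} y {x = x} ρx≡σx with x ≟ y
... | yes refl = trans (≔-same ρ x) (sym (≔-same σ x))
... | no x≢y = trans (≔-other ρ x≢y) (trans ρx≡σx (sym (≔-other σ x≢y)))

≔true-preserves : (ρ : Assignment n) (y : Fin n) {x : Fin n} → ρ x ≡ true → (ρ [ y ≔ true ]) x ≡ true
≔true-preserves ρ y {x} ρx≡true with x ≟ y
... | yes refl = ≔-same ρ x
... | no x≢y = trans (≔-other ρ x≢y) ρx≡true

true⇒ : (b : Bool) → (true ⇒ b) ≡ b
true⇒ true = refl
true⇒ false = refl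

⇒true : (b : Bool) → (b ⇒ true) ≡ true
⇒true true = refl
⇒true false = refl

⇒false-injective : (a b : Bool) → (a ⇒ false) ≡ (b ⇒ false) → a ≡ b
⇒false-injective true true _ = refl
⇒false-injective false false _ = refl

data _∈ₜ_ {n} (x : Fin n) : Term n → Set where
  var∈ : x ∈ₜ var x
  ·∈ˡ : ∀ {s u} → x ∈ₜ s → x ∈ₜ (s · u)
  ·∈ʳ : ∀ {s u} → x ∈ₜ u → x ∈ₜ (s · u)

_∉ₜ_ : Fin n → Term n → Set
x ∉ₜ t = ¬ (x ∈ₜ t)

_∈ₜ?_ : (x : Fin n) (t : Term n) → Dec (x ∈ₜ t)
x ∈ₜ? var y with x ≟ y
... | yes refl = yes var∈
... | no x≢y = no λ { var∈ → x≢y refl }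
x ∈ₜ? (s · u) with x ∈ₜ? s | x ∈ₜ? u
... | yes x∈s | _ = yes (·∈ˡ x∈s)
... | no _ | yes x∈u = yes (·∈ʳ x∈u)
... | no x∉s | no x∉u = no λ { (·∈ˡ x∈s) → x∉s x∈s ; (·∈ʳ x∈u) → x∉u x∈u }

Disjointₜ : Term n → Term n → Set
Disjointₜ s u = ∀ {x} → x ∈ₜ s → x ∈ₜ u → ⊥

Disjointₜ⇒≢ : {s u : Term n} {x y : Fin n} → Disjointₜ s u → x ∈ₜ s → y ∈ₜ u → x ≢ y
Disjointₜ⇒≢ s#u x∈s y∈u refl = s#u x∈s y∈u

data Linear {n} : Term n → Set where
  var : ∀ {x} → Linear (var x)
  _·_⟨_⟩ : ∀ {s u} → Linear s → Linear u → Disjointₜ s u → Linear (s · u)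

linear-·⁻ : {s u : Term n} → Linear (s · u) → Linear s × Linear u
linear-·⁻ (lin-s · lin-u ⟨ _ ⟩) = lin-s , lin-u

disjoint-·⁻ : {s u : Term n} → Linear (s · u) → Disjointₜ s u
disjoint-·⁻ (_ · _ ⟨ s#u ⟩) = s#u

headVar : Term n → Fin n
headVar (var x) = x
headVar (s · u) = headVar s

headVar∈ : (t : Term n) → headVar t ∈ₜ t
headVar∈ (var x) = var∈
headVar∈ (s · u) = ·∈ˡ (headVar∈ s)

eval-cong : (t : Term n) {ρ σ : Assignment n} → (∀ {x} → x ∈ₜ t → ρ x ≡ σ x) → eval t ρ ≡ eval t σ
eval-cong (var x) ρ≗σ = ρ≗σ var∈
eval-cong (s · u) ρ≗σ = cong₂ _⇐_ (eval-cong s (ρ≗σ ∘ ·∈ˡ)) (eval-cong u (ρ≗σ ∘ ·∈ʳ))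

eval-headTrue : (t : Term n) {ρ : Assignment n} → ρ (headVar t) ≡ true → eval t ρ ≡ true
eval-headTrue (var x) ρh = ρh
eval-headTrue (s · u) {ρ} ρh = trans (cong (eval u ρ ⇒_) (eval-headTrue s ρh)) (⇒true (eval u ρ))

HeadOnlyFalse : Term n → Assignment n → Set
HeadOnlyFalse t σ = σ (headVar t) ≡ false × (∀ {x} → x ∈ₜ t → x ≢ headVar t → σ x ≡ true)

eval-headOnlyFalse : {t : Term n} {σ : Assignment n} → Linear t → HeadOnlyFalse t σ → eval t σ ≡ false
eval-headOnlyFalse var (σh , _) = σh
eval-headOnlyFalse {t = s · u} {σ} (lin-s · lin-u ⟨ s#u ⟩) (σh , σrest) = begin
  (eval u σ ⇒ eval s σ) ≡⟨ cong₂ _⇒_ (eval-headTrue u u-head) (eval-headOnlyFalse lin-s (σh , σrest ∘ ·∈ˡ)) ⟩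
  (true ⇒ false)        ∎
  where
  open ≡-Reasoning
  u-head : σ (headVar u) ≡ true
  u-head = σrest (·∈ʳ (headVar∈ u)) (Disjointₜ⇒≢ s#u (headVar∈ s) (headVar∈ u) ∘ sym)

HeadOnlyFalse-resp : {t : Term n} {σ τ : Assignment n} →
                     (∀ {x} → x ∈ₜ t → σ x ≡ τ x) → HeadOnlyFalse t σ → HeadOnlyFalse t τ
HeadOnlyFalse-resp {t = t} σ≗τ (σh , σrest) =
  trans (sym (σ≗τ (headVar∈ t))) σh , λ x∈t x≢h → trans (sym (σ≗τ x∈t)) (σrest x∈t x≢h)

HeadOnlyFalse-≔true : {t : Term n} {σ : Assignment n} {y : Fin n} →
                      y ≢ headVar t → HeadOnlyFalse t σ → HeadOnlyFalse t (σ [ y ≔ true ])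
HeadOnlyFalse-≔true {σ = σ} {y} y≢h (σh , σrest) =
  trans (≔-other σ (y≢h ∘ sym)) σh , λ x∈t x≢h → ≔true-preserves σ y (σrest x∈t x≢h)

falsifier : Term n → Assignment n
falsifier t = const true [ headVar t ≔ false ]

falsifier-headOnlyFalse : (t : Term n) → HeadOnlyFalse t (falsifier t)
falsifier-headOnlyFalse t = ≔-same (const true) (headVar t) , λ _ x≢h → ≔-other (const true) x≢h

overrideOn : Term n → Assignment n → Assignment n → Assignment n
overrideOn t σ ρ x with x ∈ₜ? t
... | yes _ = σ x
... | no _ = ρ x

overrideOn-∈ : (t : Term n) (σ ρ : Assignment n) {x : Fin n} → x ∈ₜ t → overrideOn t σ ρ x ≡ σ x
overrideOn-∈ t σ ρ {x} x∈t with x ∈ₜ? t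
... | yes _ = refl
... | no x∉t = ⊥-elim (x∉t x∈t)

overrideOn-∉ : (t : Term n) (σ ρ : Assignment n) {x : Fin n} → x ∉ₜ t → overrideOn t σ ρ x ≡ ρ x
overrideOn-∉ t σ ρ {x} x∉t with x ∈ₜ? t
... | yes x∈t = ⊥-elim (x∉t x∈t)
... | no _ = refl

falsifyOn : Term n → Assignment n → Assignment n
falsifyOn t = overrideOn t (falsifier t)

falsifyOn-headOnlyFalse : (t : Term n) (ρ : Assignment n) → HeadOnlyFalse t (falsifyOn t ρ)
falsifyOn-headOnlyFalse t ρ =
  HeadOnlyFalse-resp (sym ∘ overrideOn-∈ t (falsifier t) ρ) (falsifier-headOnlyFalse t)

eval-·-argTrue : (s u : Term n) {ρ : Assignment n} → eval u ρ ≡ true → eval (s · u) ρ ≡ eval s ρ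
eval-·-argTrue s u {ρ} u-true = trans (cong (_⇒ eval s ρ) u-true) (true⇒ (eval s ρ))

-- The tree of a linear term: x t₁ ⋯ tₖ (nested to the left) has root x and subtrees t₁, …, tₖ.
-- Leaf t ℓ p says that ℓ is a leaf of this tree with parent p.

data Leaf {n} : Term n → Fin n → Fin n → Set where
  leafHere : ∀ {s ℓ} → Leaf (s · var ℓ) ℓ (headVar s)
  leafˡ : ∀ {s u ℓ p} → Leaf s ℓ p → Leaf (s · u) ℓ p
  leafʳ : ∀ {s u ℓ p} → Leaf u ℓ p → Leaf (s · u) ℓ p

leaf∈ₜ : {t : Term n} {ℓ p : Fin n} → Leaf t ℓ p → ℓ ∈ₜ t
leaf∈ₜ leafHere = ·∈ʳ var∈
leaf∈ₜ (leafˡ L) = ·∈ˡ (leaf∈ₜ L)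
leaf∈ₜ (leafʳ L) = ·∈ʳ (leaf∈ₜ L)

parent∈ₜ : {t : Term n} {ℓ p : Fin n} → Leaf t ℓ p → p ∈ₜ t
parent∈ₜ (leafHere {s}) = ·∈ˡ (headVar∈ s)
parent∈ₜ (leafˡ L) = ·∈ˡ (parent∈ₜ L)
parent∈ₜ (leafʳ L) = ·∈ʳ (parent∈ₜ L)

raise : Fin n → Fin n → Assignment n → Assignment n
raise ℓ p ρ = ρ [ ℓ ≔ true ] [ p ≔ true ]

raise-other : (ρ : Assignment n) {ℓ p x : Fin n} → x ≢ ℓ → x ≢ p → raise ℓ p ρ x ≡ ρ x
raise-other ρ x≢ℓ x≢p = trans (≔-other _ x≢p) (≔-other ρ x≢ℓ)

raise-cong : {ρ σ : Assignment n} (ℓ p : Fin n) {x : Fin n} → ρ x ≡ σ x → raise ℓ p ρ x ≡ raise ℓ p σ x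
raise-cong ℓ p ρx≡σx = ≔-cong p (≔-cong ℓ ρx≡σx)

raise-true : (ρ : Assignment n) (ℓ p : Fin n) {x : Fin n} → ρ x ≡ true → raise ℓ p ρ x ≡ true
raise-true ρ ℓ p ρx = ≔true-preserves _ p (≔true-preserves ρ ℓ ρx)

raise-leaf : (ρ : Assignment n) (ℓ p : Fin n) → raise ℓ p ρ ℓ ≡ true
raise-leaf ρ ℓ p = ≔true-preserves _ p (≔-same ρ ℓ)

raise-parent : (ρ : Assignment n) (ℓ p : Fin n) → raise ℓ p ρ p ≡ true
raise-parent ρ ℓ p = ≔-same _ p

eval-raise-∉ : (t : Term n) (ρ : Assignment n) {ℓ p : Fin n} → ℓ ∉ₜ t → p ∉ₜ t → eval t (raise ℓ p ρ) ≡ eval t ρ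
eval-raise-∉ t ρ ℓ∉t p∉t = eval-cong t λ x∈t →
  raise-other ρ (λ { refl → ℓ∉t x∈t }) (λ { refl → p∉t x∈t })

-- A leaf is visible in the term operation: while ℓ = 0 its subterm s · ℓ is 1 whatever s is,
-- so raising ℓ and its parent p = headVar s to 1 changes nothing.

SemanticLeaf : (Assignment n → Bool) → Fin n → Fin n → Set
SemanticLeaf φ ℓ p = ∀ ρ → ρ ℓ ≡ false → φ ρ ≡ φ (raise ℓ p ρ)

leaf⇒semanticLeaf : {t : Term n} {ℓ p : Fin n} → Linear t → Leaf t ℓ p → SemanticLeaf (eval t) ℓ p
leaf⇒semanticLeaf {t = s · var ℓ} {p = p} _ leafHere ρ ρℓ = begin
  (ρ ℓ ⇒ eval s ρ)   ≡⟨ cong (_⇒ eval s ρ) ρℓ ⟩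
  true               ≡⟨ sym (⇒true (σ ℓ)) ⟩
  (σ ℓ ⇒ true)       ≡⟨ cong (σ ℓ ⇒_) (sym (eval-headTrue s (raise-parent ρ ℓ p))) ⟩
  (σ ℓ ⇒ eval s σ)   ∎
  where
  open ≡-Reasoning
  σ = raise ℓ p ρ
leaf⇒semanticLeaf {t = s · u} (lin-s · _ ⟨ s#u ⟩) (leafˡ L) ρ ρℓ =
  cong₂ _⇒_ (sym (eval-raise-∉ u ρ (s#u (leaf∈ₜ L)) (s#u (parent∈ₜ L))))
            (leaf⇒semanticLeaf lin-s L ρ ρℓ)
leaf⇒semanticLeaf {t = s · u} (_ · lin-u ⟨ s#u ⟩) (leafʳ L) ρ ρℓ =
  cong₂ _⇒_ (leaf⇒semanticLeaf lin-u L ρ ρℓ)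
            (sym (eval-raise-∉ s ρ (λ ℓ∈s → s#u ℓ∈s (leaf∈ₜ L)) (λ p∈s → s#u p∈s (parent∈ₜ L))))

false≢true : false ≢ true
false≢true ()

var-notSemanticLeaf : {x p : Fin n} → ¬ SemanticLeaf (eval (var x)) x p
var-notSemanticLeaf {x = x} {p} H = false≢true (trans (H (const false) refl) (raise-leaf (const false) x p))

semanticLeaf-left : {s u : Term n} {ℓ p : Fin n} → Linear (s · u) → ℓ ∈ₜ s →
                    SemanticLeaf (eval (s · u)) ℓ p → SemanticLeaf (eval s) ℓ p
semanticLeaf-left {s = s} {u} {ℓ} {p} (_ · _ ⟨ s#u ⟩) ℓ∈s H ρ ρℓ = begin
  eval s ρ                     ≡⟨ eval-cong s (sym ∘ agree) ⟩
  eval s ρ′                    ≡⟨ sym (eval-·-argTrue s u (eval-headTrue u (≔-same ρ (headVar u)))) ⟩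
  eval (s · u) ρ′              ≡⟨ H ρ′ (trans (agree ℓ∈s) ρℓ) ⟩
  eval (s · u) (raise ℓ p ρ′)  ≡⟨ eval-·-argTrue s u (eval-headTrue u (raise-true ρ′ ℓ p (≔-same ρ (headVar u)))) ⟩
  eval s (raise ℓ p ρ′)        ≡⟨ eval-cong s (raise-cong ℓ p ∘ agree) ⟩
  eval s (raise ℓ p ρ)         ∎
  where
  open ≡-Reasoning
  ρ′ = ρ [ headVar u ≔ true ]
  agree : ∀ {x} → x ∈ₜ s → ρ′ x ≡ ρ x
  agree x∈s = ≔-other ρ (Disjointₜ⇒≢ s#u x∈s (headVar∈ u))

semanticLeaf-right : {s u : Term n} {ℓ p : Fin n} → Linear (s · u) → ℓ ∈ₜ u → p ≢ headVar s →
                     SemanticLeaf (eval (s · u)) ℓ p → SemanticLeaf (eval u) ℓ p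
semanticLeaf-right {s = s} {u} {ℓ} {p} (lin-s · _ ⟨ s#u ⟩) ℓ∈u p≢h H ρ ρℓ = begin
  eval u ρ                  ≡⟨ eval-cong u (sym ∘ agree) ⟩
  eval u ρ′                 ≡⟨ ⇒false-injective _ _ negated ⟩
  eval u (raise ℓ p ρ′)     ≡⟨ eval-cong u (raise-cong ℓ p ∘ agree) ⟩
  eval u (raise ℓ p ρ)      ∎
  where
  open ≡-Reasoning
  ρ′ = falsifyOn s ρ
  agree : ∀ {x} → x ∈ₜ u → ρ′ x ≡ ρ x
  agree x∈u = overrideOn-∉ s (falsifier s) ρ (λ x∈s → s#u x∈s x∈u)
  ℓ≢h : ℓ ≢ headVar s
  ℓ≢h = Disjointₜ⇒≢ s#u (headVar∈ s) ℓ∈u ∘ sym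
  s-false : eval s ρ′ ≡ false
  s-false = eval-headOnlyFalse lin-s (falsifyOn-headOnlyFalse s ρ)
  s-false-raised : eval s (raise ℓ p ρ′) ≡ false
  s-false-raised = eval-headOnlyFalse lin-s
    (HeadOnlyFalse-≔true p≢h (HeadOnlyFalse-≔true ℓ≢h (falsifyOn-headOnlyFalse s ρ)))
  negated : (eval u ρ′ ⇒ false) ≡ (eval u (raise ℓ p ρ′) ⇒ false)
  negated = begin
    (eval u ρ′ ⇒ false)                            ≡⟨ cong (eval u ρ′ ⇒_) (sym s-false) ⟩
    eval (s · u) ρ′                                ≡⟨ H ρ′ (trans (agree ℓ∈u) ρℓ) ⟩
    eval (s · u) (raise ℓ p ρ′)                    ≡⟨ cong (eval u (raise ℓ p ρ′) ⇒_) s-false-raised ⟩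
    (eval u (raise ℓ p ρ′) ⇒ false)                ∎

leafParent-head : {s : Term n} {ℓ p : Fin n} → Linear (s · var ℓ) →
                  SemanticLeaf (eval (s · var ℓ)) ℓ p → p ≡ headVar s
leafParent-head {s = s} {ℓ} {p} (lin-s · _ ⟨ s#ℓ ⟩) H with p ≟ headVar s
... | yes p≡h = p≡h
... | no p≢h = ⊥-elim (false≢true (sym (begin
  true                         ≡⟨ cong (_⇒ eval s ρ) (sym ρℓ) ⟩
  (ρ ℓ ⇒ eval s ρ)             ≡⟨ H ρ ρℓ ⟩
  (σ ℓ ⇒ eval s σ)             ≡⟨ cong₂ _⇒_ (raise-leaf ρ ℓ p) s-false ⟩
  false                        ∎)))
  where
  open ≡-Reasoning
  ρ = falsifyOn s (const false)
  σ = raise ℓ p ρ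
  ℓ∉s : ℓ ∉ₜ s
  ℓ∉s ℓ∈s = s#ℓ ℓ∈s var∈
  ρℓ : ρ ℓ ≡ false
  ρℓ = overrideOn-∉ s (falsifier s) (const false) ℓ∉s
  s-false : eval s σ ≡ false
  s-false = eval-headOnlyFalse lin-s
    (HeadOnlyFalse-≔true p≢h (HeadOnlyFalse-≔true (λ { refl → ℓ∉s (headVar∈ s) })
      (falsifyOn-headOnlyFalse s (const false))))

compound-trueWith-false : {u₁ u₂ : Term n} → Linear (u₁ · u₂) → (ℓ : Fin n) →
                          ∃ λ τ → τ ℓ ≡ false × eval (u₁ · u₂) τ ≡ true
compound-trueWith-false {u₁ = u₁} {u₂} (_ · lin-u₂ ⟨ u₁#u₂ ⟩) ℓ with ℓ ≟ headVar u₁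
... | yes refl = τ , overrideOn-∉ u₂ (falsifier u₂) (const false) (u₁#u₂ (headVar∈ u₁)) ,
                 cong (_⇒ eval u₁ τ) (eval-headOnlyFalse lin-u₂ (falsifyOn-headOnlyFalse u₂ (const false)))
  where τ = falsifyOn u₂ (const false)
... | no ℓ≢h = const false [ headVar u₁ ≔ true ] , ≔-other (const false) ℓ≢h ,
               eval-headTrue (u₁ · u₂) (≔-same (const false) (headVar u₁))

compoundLeaf-parent≢head : {s u₁ u₂ : Term n} {ℓ : Fin n} → Linear (s · (u₁ · u₂)) → ℓ ∈ₜ (u₁ · u₂) →
                           ¬ SemanticLeaf (eval (s · (u₁ · u₂))) ℓ (headVar s)
compoundLeaf-parent≢head {s = s} {u₁} {u₂} {ℓ} (lin-s · lin-u ⟨ s#u ⟩) ℓ∈u H = false≢true (begin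
  false                        ≡⟨ cong₂ _⇒_ (sym u-true) (sym s-false) ⟩
  eval (s · u) ρ               ≡⟨ H ρ ρℓ ⟩
  eval (s · u) (raise ℓ h ρ)   ≡⟨ eval-headTrue (s · u) (raise-parent ρ ℓ h) ⟩
  true                         ∎)
  where
  open ≡-Reasoning
  u = u₁ · u₂
  h = headVar s
  τ = proj₁ (compound-trueWith-false lin-u ℓ)
  ρ = falsifyOn s τ
  agree : ∀ {x} → x ∈ₜ u → ρ x ≡ τ x
  agree x∈u = overrideOn-∉ s (falsifier s) τ (λ x∈s → s#u x∈s x∈u)
  ρℓ : ρ ℓ ≡ false
  ρℓ = trans (agree ℓ∈u) (proj₁ (proj₂ (compound-trueWith-false lin-u ℓ)))
  u-true : eval u ρ ≡ true
  u-true = trans (eval-cong u agree) (proj₂ (proj₂ (compound-trueWith-false lin-u ℓ)))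
  s-false : eval s ρ ≡ false
  s-false = eval-headOnlyFalse lin-s (falsifyOn-headOnlyFalse s τ)

semanticLeaf⇒leaf : {t : Term n} {ℓ p : Fin n} → Linear t → ℓ ∈ₜ t → SemanticLeaf (eval t) ℓ p → Leaf t ℓ p
semanticLeaf⇒leaf {t = var x} _ var∈ H = ⊥-elim (var-notSemanticLeaf H)
semanticLeaf⇒leaf lin@(lin-s · _ ⟨ _ ⟩) (·∈ˡ ℓ∈s) H =
  leafˡ (semanticLeaf⇒leaf lin-s ℓ∈s (semanticLeaf-left lin ℓ∈s H))
semanticLeaf⇒leaf {t = s · var ℓ} lin (·∈ʳ var∈) H rewrite leafParent-head lin H = leafHere
semanticLeaf⇒leaf {t = s · (u₁ · u₂)} {p = p} lin@(_ · lin-u ⟨ _ ⟩) (·∈ʳ ℓ∈u) H with p ≟ headVar s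
... | yes refl = ⊥-elim (compoundLeaf-parent≢head lin ℓ∈u H)
... | no p≢h = leafʳ (semanticLeaf⇒leaf lin-u ℓ∈u (semanticLeaf-right lin ℓ∈u p≢h H))

leaf-·-inv : {s u : Term n} {ℓ p : Fin n} → Leaf (s · u) ℓ p →
             (u ≡ var ℓ × p ≡ headVar s) ⊎ Leaf s ℓ p ⊎ Leaf u ℓ p
leaf-·-inv leafHere = inj₁ (refl , refl)
leaf-·-inv (leafˡ L) = inj₂ (inj₁ L)
leaf-·-inv (leafʳ L) = inj₂ (inj₂ L)

leaf-unique : {t : Term n} {ℓ p q : Fin n} → Linear t → Leaf t ℓ p → Leaf t ℓ q → p ≡ q
leaf-unique _ leafHere leafHere = refl
leaf-unique (_ · _ ⟨ s#u ⟩) leafHere (leafˡ L) = ⊥-elim (s#u (leaf∈ₜ L) var∈)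
leaf-unique (_ · _ ⟨ s#u ⟩) (leafˡ L) leafHere = ⊥-elim (s#u (leaf∈ₜ L) var∈)
leaf-unique (lin-s · _ ⟨ _ ⟩) (leafˡ L) (leafˡ K) = leaf-unique lin-s L K
leaf-unique (_ · _ ⟨ s#u ⟩) (leafˡ L) (leafʳ K) = ⊥-elim (s#u (leaf∈ₜ L) (leaf∈ₜ K))
leaf-unique (_ · _ ⟨ s#u ⟩) (leafʳ L) (leafˡ K) = ⊥-elim (s#u (leaf∈ₜ K) (leaf∈ₜ L))
leaf-unique (_ · lin-u ⟨ _ ⟩) (leafʳ L) (leafʳ K) = leaf-unique lin-u L K

root-notLeaf : {t : Term n} {q : Fin n} → Linear t → ¬ Leaf t (headVar t) q
root-notLeaf {t = s · _} (_ · _ ⟨ s#u ⟩) leafHere = s#u (headVar∈ s) var∈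
root-notLeaf (lin-s · _ ⟨ _ ⟩) (leafˡ L) = root-notLeaf lin-s L
root-notLeaf {t = s · _} (_ · _ ⟨ s#u ⟩) (leafʳ L) = s#u (headVar∈ s) (leaf∈ₜ L)

leaf≢root : {t : Term n} {ℓ p : Fin n} → Linear t → Leaf t ℓ p → ℓ ≢ headVar t
leaf≢root lin L refl = root-notLeaf lin L

parent-notLeaf : {t : Term n} {ℓ p q : Fin n} → Linear t → Leaf t ℓ p → ¬ Leaf t p q
parent-notLeaf {t = s · _} (lin-s · _ ⟨ s#u ⟩) leafHere K with leaf-·-inv K
... | inj₁ (refl , _) = s#u (headVar∈ s) var∈
... | inj₂ (inj₁ K′) = root-notLeaf lin-s K′
... | inj₂ (inj₂ ())
parent-notLeaf (lin-s · _ ⟨ s#u ⟩) (leafˡ L) K with leaf-·-inv K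
... | inj₁ (refl , _) = s#u (parent∈ₜ L) var∈
... | inj₂ (inj₁ K′) = parent-notLeaf lin-s L K′
... | inj₂ (inj₂ K′) = s#u (parent∈ₜ L) (leaf∈ₜ K′)
parent-notLeaf (_ · lin-u ⟨ s#u ⟩) (leafʳ L) K with leaf-·-inv K
... | inj₁ (refl , _) = case L of λ ()
... | inj₂ (inj₁ K′) = s#u (leaf∈ₜ K′) (parent∈ₜ L)
... | inj₂ (inj₂ K′) = parent-notLeaf lin-u L K′

parent≢leaf : {t : Term n} {ℓ p : Fin n} → Linear t → Leaf t ℓ p → p ≢ ℓ
parent≢leaf lin L refl = parent-notLeaf lin L L

compound-hasLeaf : (s u : Term n) → ∃₂ λ ℓ p → Leaf (s · u) ℓ p
compound-hasLeaf s (var x) = x , headVar s , leafHere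
compound-hasLeaf s (u₁ · u₂) with compound-hasLeaf u₁ u₂
... | ℓ , p , L = ℓ , p , leafʳ L

-- Grafting and pruning leaves

attach : Fin n → Fin n → Term n → Term n
attach a ℓ (var x) with x ≟ a
... | yes _ = var x · var ℓ
... | no _ = var x
attach a ℓ (s · u) = attach a ℓ s · attach a ℓ u

attach-var-self : (a ℓ : Fin n) → attach a ℓ (var a) ≡ var a · var ℓ
attach-var-self a ℓ with a ≟ a
... | yes _ = refl
... | no a≢a = ⊥-elim (a≢a refl)

attach-var-other : (a ℓ : Fin n) {x : Fin n} → x ≢ a → attach a ℓ (var x) ≡ var x
attach-var-other a ℓ {x} x≢a with x ≟ a
... | yes x≡a = ⊥-elim (x≢a x≡a)
... | no _ = refl

headVar-attach : (a ℓ : Fin n) (t : Term n) → headVar (attach a ℓ t) ≡ headVar t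
headVar-attach a ℓ (var x) with x ≟ a
... | yes _ = refl
... | no _ = refl
headVar-attach a ℓ (s · u) = headVar-attach a ℓ s

∈-attach⁻ : (a ℓ : Fin n) (t : Term n) {x : Fin n} → x ∈ₜ attach a ℓ t → x ∈ₜ t ⊎ (x ≡ ℓ × a ∈ₜ t)
∈-attach⁻ a ℓ (var y) x∈ with y ≟ a
∈-attach⁻ a ℓ (var y) (·∈ˡ var∈) | yes _ = inj₁ var∈
∈-attach⁻ a ℓ (var y) (·∈ʳ var∈) | yes refl = inj₂ (refl , var∈)
∈-attach⁻ a ℓ (var y) var∈ | no _ = inj₁ var∈
∈-attach⁻ a ℓ (s · u) (·∈ˡ x∈) with ∈-attach⁻ a ℓ s x∈
... | inj₁ x∈s = inj₁ (·∈ˡ x∈s)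
... | inj₂ (x≡ℓ , a∈s) = inj₂ (x≡ℓ , ·∈ˡ a∈s)
∈-attach⁻ a ℓ (s · u) (·∈ʳ x∈) with ∈-attach⁻ a ℓ u x∈
... | inj₁ x∈u = inj₁ (·∈ʳ x∈u)
... | inj₂ (x≡ℓ , a∈u) = inj₂ (x≡ℓ , ·∈ʳ a∈u)

∈-attach⁺ : (a ℓ : Fin n) (t : Term n) {x : Fin n} → x ∈ₜ t → x ∈ₜ attach a ℓ t
∈-attach⁺ a ℓ (var y) var∈ with y ≟ a
... | yes _ = ·∈ˡ var∈
... | no _ = var∈
∈-attach⁺ a ℓ (s · u) (·∈ˡ x∈s) = ·∈ˡ (∈-attach⁺ a ℓ s x∈s)
∈-attach⁺ a ℓ (s · u) (·∈ʳ x∈u) = ·∈ʳ (∈-attach⁺ a ℓ u x∈u)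

attach-leaf : (a ℓ : Fin n) (t : Term n) → a ∈ₜ t → Leaf (attach a ℓ t) ℓ a
attach-leaf a ℓ (var a) var∈ = subst (λ w → Leaf w ℓ a) (sym (attach-var-self a ℓ)) leafHere
attach-leaf a ℓ (s · u) (·∈ˡ a∈s) = leafˡ (attach-leaf a ℓ s a∈s)
attach-leaf a ℓ (s · u) (·∈ʳ a∈u) = leafʳ (attach-leaf a ℓ u a∈u)

attach-linear : (a ℓ : Fin n) {t : Term n} → Linear t → ℓ ∉ₜ t → Linear (attach a ℓ t)
attach-linear a ℓ {var y} var ℓ∉t with y ≟ a
... | yes _ = var · var ⟨ (λ { var∈ var∈ → ℓ∉t var∈ }) ⟩
... | no _ = var
attach-linear a ℓ {s · u} (lin-s · lin-u ⟨ s#u ⟩) ℓ∉t =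
  attach-linear a ℓ lin-s (ℓ∉t ∘ ·∈ˡ) · attach-linear a ℓ lin-u (ℓ∉t ∘ ·∈ʳ) ⟨ disjoint ⟩
  where
  disjoint : Disjointₜ (attach a ℓ s) (attach a ℓ u)
  disjoint x∈ x∈′ with ∈-attach⁻ a ℓ s x∈ | ∈-attach⁻ a ℓ u x∈′
  ... | inj₁ x∈s | inj₁ x∈u = s#u x∈s x∈u
  ... | inj₁ x∈s | inj₂ (refl , _) = ℓ∉t (·∈ˡ x∈s)
  ... | inj₂ (refl , _) | inj₁ x∈u = ℓ∉t (·∈ʳ x∈u)
  ... | inj₂ (_ , a∈s) | inj₂ (_ , a∈u) = s#u a∈s a∈u

eval-attach : (a ℓ : Fin n) (t : Term n) (σ : Assignment n) →
              eval (attach a ℓ t) σ ≡ eval t (σ [ a ≔ (σ ℓ ⇒ σ a) ])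
eval-attach a ℓ (var y) σ with y ≟ a
... | yes refl = sym (≔-same σ y)
... | no y≢a = sym (≔-other σ y≢a)
eval-attach a ℓ (s · u) σ = cong₂ _⇐_ (eval-attach a ℓ s σ) (eval-attach a ℓ u σ)

attach-keepsLeaf : (a ℓ : Fin n) {t : Term n} {x q : Fin n} → Leaf t x q → x ≢ a → Leaf (attach a ℓ t) x q
attach-keepsLeaf a ℓ {s · var x} leafHere x≢a =
  subst₂ (λ w z → Leaf (attach a ℓ s · w) x z) (sym (attach-var-other a ℓ x≢a)) (headVar-attach a ℓ s) leafHere
attach-keepsLeaf a ℓ (leafˡ L) x≢a = leafˡ (attach-keepsLeaf a ℓ L x≢a)
attach-keepsLeaf a ℓ (leafʳ L) x≢a = leafʳ (attach-keepsLeaf a ℓ L x≢a)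

attach≡var : (a ℓ : Fin n) (t : Term n) {x : Fin n} → attach a ℓ t ≡ var x → t ≡ var x × x ≢ a
attach≡var a ℓ (var y) e with y ≟ a
attach≡var a ℓ (var y) () | yes _
attach≡var a ℓ (var y) refl | no y≢a = refl , y≢a

attach-leaf⁻ : (a ℓ : Fin n) (t : Term n) {x q : Fin n} → Leaf (attach a ℓ t) x q →
               (x ≡ ℓ × q ≡ a) ⊎ (Leaf t x q × x ≢ a)
attach-leaf⁻ a ℓ (var y) L with y ≟ a
attach-leaf⁻ a ℓ (var y) leafHere | yes refl = inj₁ (refl , refl)
attach-leaf⁻ a ℓ (var y) (leafˡ ()) | yes refl
attach-leaf⁻ a ℓ (var y) (leafʳ ()) | yes refl
attach-leaf⁻ a ℓ (var y) () | no _
attach-leaf⁻ a ℓ (s · u) L with leaf-·-inv L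
... | inj₁ (e , refl) with attach≡var a ℓ u e
... | refl , x≢a = inj₂ (subst (Leaf (s · u) _) (sym (headVar-attach a ℓ s)) leafHere , x≢a)
attach-leaf⁻ a ℓ (s · u) L | inj₂ (inj₁ L′) with attach-leaf⁻ a ℓ s L′
... | inj₁ new = inj₁ new
... | inj₂ (L″ , x≢a) = inj₂ (leafˡ L″ , x≢a)
attach-leaf⁻ a ℓ (s · u) L | inj₂ (inj₂ L′) with attach-leaf⁻ a ℓ u L′
... | inj₁ new = inj₁ new
... | inj₂ (L″ , x≢a) = inj₂ (leafʳ L″ , x≢a)

detach : Fin n → Term n → Term n
detach ℓ (var x) = var x
detach ℓ (s · var y) with y ≟ ℓ
... | yes _ = s
... | no _ = detach ℓ s · var y
detach ℓ (s · (u₁ · u₂)) = detach ℓ s · detach ℓ (u₁ · u₂)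

detach-∉ : (ℓ : Fin n) (t : Term n) → ℓ ∉ₜ t → detach ℓ t ≡ t
detach-∉ ℓ (var x) _ = refl
detach-∉ ℓ (s · var y) ℓ∉t with y ≟ ℓ
... | yes refl = ⊥-elim (ℓ∉t (·∈ʳ var∈))
... | no _ = cong (_· var y) (detach-∉ ℓ s (ℓ∉t ∘ ·∈ˡ))
detach-∉ ℓ (s · (u₁ · u₂)) ℓ∉t = cong₂ _·_ (detach-∉ ℓ s (ℓ∉t ∘ ·∈ˡ)) (detach-∉ ℓ (u₁ · u₂) (ℓ∉t ∘ ·∈ʳ))

headVar-detach : (ℓ : Fin n) (t : Term n) → ℓ ≢ headVar t → headVar (detach ℓ t) ≡ headVar t
headVar-detach ℓ (var x) _ = refl
headVar-detach ℓ (s · var y) ℓ≢h with y ≟ ℓ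
... | yes _ = refl
... | no _ = headVar-detach ℓ s ℓ≢h
headVar-detach ℓ (s · (u₁ · u₂)) ℓ≢h = headVar-detach ℓ s ℓ≢h

∈-detach⁻ : (ℓ : Fin n) (t : Term n) {x : Fin n} → x ∈ₜ detach ℓ t → x ∈ₜ t
∈-detach⁻ ℓ (var y) x∈ = x∈
∈-detach⁻ ℓ (s · var y) x∈ with y ≟ ℓ
... | yes _ = ·∈ˡ x∈
∈-detach⁻ ℓ (s · var y) (·∈ˡ x∈) | no _ = ·∈ˡ (∈-detach⁻ ℓ s x∈)
∈-detach⁻ ℓ (s · var y) (·∈ʳ x∈) | no _ = ·∈ʳ x∈
∈-detach⁻ ℓ (s · (u₁ · u₂)) (·∈ˡ x∈) = ·∈ˡ (∈-detach⁻ ℓ s x∈)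
∈-detach⁻ ℓ (s · (u₁ · u₂)) (·∈ʳ x∈) = ·∈ʳ (∈-detach⁻ ℓ (u₁ · u₂) x∈)

∈-detach⁺ : (ℓ : Fin n) (t : Term n) {x : Fin n} → x ∈ₜ t → x ≢ ℓ → x ∈ₜ detach ℓ t
∈-detach⁺ ℓ (var y) x∈ _ = x∈
∈-detach⁺ ℓ (s · var y) x∈ x≢ℓ with y ≟ ℓ
∈-detach⁺ ℓ (s · var y) (·∈ˡ x∈) x≢ℓ | yes _ = x∈
∈-detach⁺ ℓ (s · var y) (·∈ʳ var∈) x≢ℓ | yes y≡ℓ = ⊥-elim (x≢ℓ y≡ℓ)
∈-detach⁺ ℓ (s · var y) (·∈ˡ x∈) x≢ℓ | no _ = ·∈ˡ (∈-detach⁺ ℓ s x∈ x≢ℓ)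
∈-detach⁺ ℓ (s · var y) (·∈ʳ x∈) x≢ℓ | no _ = ·∈ʳ x∈
∈-detach⁺ ℓ (s · (u₁ · u₂)) (·∈ˡ x∈) x≢ℓ = ·∈ˡ (∈-detach⁺ ℓ s x∈ x≢ℓ)
∈-detach⁺ ℓ (s · (u₁ · u₂)) (·∈ʳ x∈) x≢ℓ = ·∈ʳ (∈-detach⁺ ℓ (u₁ · u₂) x∈ x≢ℓ)

detach-linear : (ℓ : Fin n) {t : Term n} → Linear t → Linear (detach ℓ t)
detach-linear ℓ {var x} lin = lin
detach-linear ℓ {s · var y} (lin-s · _ ⟨ s#u ⟩) with y ≟ ℓ
... | yes _ = lin-s
... | no _ = detach-linear ℓ lin-s · var ⟨ s#u ∘ ∈-detach⁻ ℓ s ⟩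
detach-linear ℓ {s · (u₁ · u₂)} (lin-s · lin-u ⟨ s#u ⟩) =
  detach-linear ℓ lin-s · detach-linear ℓ lin-u ⟨ (λ x∈ x∈′ → s#u (∈-detach⁻ ℓ s x∈) (∈-detach⁻ ℓ (u₁ · u₂) x∈′)) ⟩

leaf-·var : {s : Term n} {y ℓ p : Fin n} → y ≢ ℓ → Leaf (s · var y) ℓ p → Leaf s ℓ p
leaf-·var y≢ℓ leafHere = ⊥-elim (y≢ℓ refl)
leaf-·var y≢ℓ (leafˡ L) = L

∈-detach⇒≢ : (ℓ : Fin n) {t : Term n} {p x : Fin n} → Linear t → Leaf t ℓ p → x ∈ₜ detach ℓ t → x ≢ ℓ
∈-detach⇒≢ ℓ {s · var y} (lin-s · _ ⟨ s#u ⟩) L x∈ with y ≟ ℓ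
... | yes refl = λ { refl → s#u x∈ var∈ }
∈-detach⇒≢ ℓ {s · var y} (lin-s · _ ⟨ s#u ⟩) L (·∈ˡ x∈) | no y≢ℓ = ∈-detach⇒≢ ℓ lin-s (leaf-·var y≢ℓ L) x∈
∈-detach⇒≢ ℓ {s · var y} (lin-s · _ ⟨ s#u ⟩) L (·∈ʳ var∈) | no y≢ℓ = y≢ℓ
∈-detach⇒≢ ℓ {s · (u₁ · u₂)} (lin-s · _ ⟨ s#u ⟩) (leafˡ L) (·∈ˡ x∈) = ∈-detach⇒≢ ℓ lin-s L x∈
∈-detach⇒≢ ℓ {s · (u₁ · u₂)} (_ · _ ⟨ s#u ⟩) (leafˡ L) (·∈ʳ x∈) =
  λ { refl → s#u (leaf∈ₜ L) (∈-detach⁻ ℓ (u₁ · u₂) x∈) }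
∈-detach⇒≢ ℓ {s · (u₁ · u₂)} (_ · _ ⟨ s#u ⟩) (leafʳ L) (·∈ˡ x∈) = λ { refl → s#u (∈-detach⁻ ℓ s x∈) (leaf∈ₜ L) }
∈-detach⇒≢ ℓ {s · (u₁ · u₂)} (_ · lin-u ⟨ s#u ⟩) (leafʳ L) (·∈ʳ x∈) = ∈-detach⇒≢ ℓ lin-u L x∈

eval-detach : (ℓ : Fin n) {t : Term n} {p : Fin n} → Linear t → Leaf t ℓ p → (ρ : Assignment n) →
              eval (detach ℓ t) ρ ≡ eval t (ρ [ ℓ ≔ true ])
eval-detach ℓ {s · var y} (lin-s · _ ⟨ s#u ⟩) L ρ with y ≟ ℓ
... | yes refl = trans (eval-cong s (λ x∈s → sym (≔-other ρ (λ { refl → s#u x∈s var∈ }))))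
                       (sym (eval-·-argTrue s (var y) (≔-same ρ y)))
... | no y≢ℓ = cong₂ _⇒_ (sym (≔-other ρ y≢ℓ)) (eval-detach ℓ lin-s (leaf-·var y≢ℓ L) ρ)
eval-detach ℓ {s · (u₁ · u₂)} (lin-s · _ ⟨ s#u ⟩) (leafˡ L) ρ =
  cong₂ _⇒_ (trans (cong (λ w → eval w ρ) (detach-∉ ℓ (u₁ · u₂) (s#u (leaf∈ₜ L))))
                   (eval-cong (u₁ · u₂) (λ x∈u → sym (≔-other ρ (λ { refl → s#u (leaf∈ₜ L) x∈u })))))
            (eval-detach ℓ lin-s L ρ)
eval-detach ℓ {s · (u₁ · u₂)} (_ · lin-u ⟨ s#u ⟩) (leafʳ L) ρ =
  cong₂ _⇒_ (eval-detach ℓ lin-u L ρ)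
            (trans (cong (λ w → eval w ρ) (detach-∉ ℓ s (λ ℓ∈s → s#u ℓ∈s (leaf∈ₜ L))))
                   (eval-cong s (λ x∈s → sym (≔-other ρ (λ { refl → s#u x∈s (leaf∈ₜ L) })))))

detach-keepsLeaf : (ℓ : Fin n) {t : Term n} {p x q : Fin n} → Linear t → Leaf t ℓ p → Leaf t x q → x ≢ ℓ →
                   Leaf (detach ℓ t) x q
detach-keepsLeaf ℓ {s · var y} (lin-s · _ ⟨ _ ⟩) L K x≢ℓ with y ≟ ℓ | K
... | yes refl | leafHere = ⊥-elim (x≢ℓ refl)
... | yes refl | leafˡ K′ = K′
... | no y≢ℓ | leafHere =
  subst (Leaf (detach ℓ s · var y) y) (headVar-detach ℓ s (leaf≢root lin-s (leaf-·var y≢ℓ L))) leafHere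
... | no y≢ℓ | leafˡ K′ = leafˡ (detach-keepsLeaf ℓ lin-s (leaf-·var y≢ℓ L) K′ x≢ℓ)
detach-keepsLeaf ℓ {s · (u₁ · u₂)} (lin-s · _ ⟨ s#u ⟩) (leafˡ L) (leafˡ K) x≢ℓ =
  leafˡ (detach-keepsLeaf ℓ lin-s L K x≢ℓ)
detach-keepsLeaf ℓ {s · (u₁ · u₂)} (_ · _ ⟨ s#u ⟩) (leafˡ L) (leafʳ K) _ =
  leafʳ (subst (λ w → Leaf w _ _) (sym (detach-∉ ℓ (u₁ · u₂) (s#u (leaf∈ₜ L)))) K)
detach-keepsLeaf ℓ {s · (u₁ · u₂)} (_ · _ ⟨ s#u ⟩) (leafʳ L) (leafˡ K) _ =
  leafˡ (subst (λ w → Leaf w _ _) (sym (detach-∉ ℓ s (λ ℓ∈s → s#u ℓ∈s (leaf∈ₜ L)))) K)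
detach-keepsLeaf ℓ {s · (u₁ · u₂)} (_ · lin-u ⟨ _ ⟩) (leafʳ L) (leafʳ K) x≢ℓ =
  leafʳ (detach-keepsLeaf ℓ lin-u L K x≢ℓ)

detach≡var⇒parent : (ℓ : Fin n) {u : Term n} {p x : Fin n} → Linear u → Leaf u ℓ p → detach ℓ u ≡ var x → x ≡ p
detach≡var⇒parent ℓ {s · var y} lin L e with y ≟ ℓ | e
... | yes refl | refl = leaf-unique lin leafHere L
... | no _ | ()

detach-leaf⁻ : (ℓ : Fin n) {t : Term n} {p x q : Fin n} → Linear t → Leaf t ℓ p → Leaf (detach ℓ t) x q → x ≢ p →
               Leaf t x q
detach-leaf⁻ ℓ {s · var y} (lin-s · _ ⟨ _ ⟩) L K x≢p with y ≟ ℓ | K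
... | yes refl | K′ = leafˡ K′
... | no y≢ℓ | leafHere =
  subst (Leaf (s · var y) y) (sym (headVar-detach ℓ s (leaf≢root lin-s (leaf-·var y≢ℓ L)))) leafHere
... | no y≢ℓ | leafˡ K′ = leafˡ (detach-leaf⁻ ℓ lin-s (leaf-·var y≢ℓ L) K′ x≢p)
detach-leaf⁻ ℓ {s · (u₁ · u₂)} (lin-s · _ ⟨ s#u ⟩) (leafˡ L) K x≢p with leaf-·-inv K
... | inj₁ (e , _) = case trans (sym (detach-∉ ℓ (u₁ · u₂) (s#u (leaf∈ₜ L)))) e of λ ()
... | inj₂ (inj₁ K′) = leafˡ (detach-leaf⁻ ℓ lin-s L K′ x≢p)
... | inj₂ (inj₂ K′) = leafʳ (subst (λ w → Leaf w _ _) (detach-∉ ℓ (u₁ · u₂) (s#u (leaf∈ₜ L))) K′)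
detach-leaf⁻ ℓ {s · (u₁ · u₂)} (_ · lin-u ⟨ s#u ⟩) (leafʳ L) K x≢p with leaf-·-inv K
... | inj₁ (e , _) = ⊥-elim (x≢p (detach≡var⇒parent ℓ lin-u L e))
... | inj₂ (inj₁ K′) = leafˡ (subst (λ w → Leaf w _ _) (detach-∉ ℓ s (λ ℓ∈s → s#u ℓ∈s (leaf∈ₜ L))) K′)
... | inj₂ (inj₂ K′) = leafʳ (detach-leaf⁻ ℓ lin-u L K′ x≢p)

remove : Fin n → List (Fin n) → List (Fin n)
remove ℓ = filter (λ x → ¬? (x ≟ ℓ))

∈-remove⁻ : (ℓ : Fin n) {V : List (Fin n)} {x : Fin n} → x ∈ remove ℓ V → x ∈ V × x ≢ ℓ
∈-remove⁻ ℓ = ∈-filter⁻ (λ x → ¬? (x ≟ ℓ))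

∈-remove⁺ : (ℓ : Fin n) {V : List (Fin n)} {x : Fin n} → x ∈ V → x ≢ ℓ → x ∈ remove ℓ V
∈-remove⁺ ℓ = ∈-filter⁺ (λ x → ¬? (x ≟ ℓ))

remove-unique : (ℓ : Fin n) {V : List (Fin n)} → Unique V → Unique (remove ℓ V)
remove-unique ℓ = Unique.filter⁺ (λ x → ¬? (x ≟ ℓ))

length-remove : (ℓ : Fin n) {V : List (Fin n)} → ℓ ∈ V → Unique V → suc (length (remove ℓ V)) ≡ length V
length-remove ℓ {x ∷ V} ℓ∈ (x∉V ∷ V!) with x ≟ ℓ | ℓ∈
... | yes refl | _ = cong (λ W → suc (length W)) (filter-all (λ y → ¬? (y ≟ ℓ)) (All.map (_∘ sym) x∉V))
... | no x≢ℓ | here ℓ≡x = ⊥-elim (x≢ℓ (sym ℓ≡x))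
... | no x≢ℓ | there ℓ∈V = cong suc (length-remove ℓ ℓ∈V V!)

unique-longer-notCovered : {V : List (Fin n)} (s : List (Fin n)) → Unique V → length s < length V →
                           ∃ λ x → x ∈ V × x ∉ s
unique-longer-notCovered {V = x ∷ V} s (x∉V ∷ V!) |s|<|V| with Any.any? (x ≟_) s
... | no x∉s = x , here refl , x∉s
... | yes x∈s with unique-longer-notCovered (remove x s) V! shorter
  where
  shorter : length (remove x s) < length V
  shorter = ≤-trans (filter-notAll (λ y → ¬? (y ≟ x)) s (Any.map (λ x≡y y≢x → y≢x (sym x≡y)) x∈s))
                    (≤-pred |s|<|V|)
... | y , y∈V , y∉s′ = y , there y∈V , λ y∈s → y∉s′ (∈-remove⁺ x y∈s y≢x)
  where
  y≢x : y ≢ x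
  y≢x refl = All.lookup x∉V y∈V refl

length≡1⇒∈-unique : {V : List (Fin n)} → length V ≡ 1 → {x y : Fin n} → x ∈ V → y ∈ V → x ≡ y
length≡1⇒∈-unique {V = _ ∷ []} _ (here refl) (here refl) = refl

module _ {A : Set} where

  find-sound : {P : Pred A 0ℓ} (P? : Decidable P) (xs : List A) {y : A} → find P? xs ≡ just y → P y × y ∈ xs
  find-sound P? (x ∷ xs) found with P? x
  find-sound P? (x ∷ xs) refl | yes Px = Px , here refl
  ... | no _ = let Py , y∈xs = find-sound P? xs found in Py , there y∈xs

  find-complete : {P : Pred A 0ℓ} (P? : Decidable P) {xs : List A} {y : A} → y ∈ xs → P y →
                  ∃ λ z → find P? xs ≡ just z
  find-complete P? {x ∷ xs} y∈ Py with P? x | y∈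
  ... | yes _ | _ = x , refl
  ... | no ¬Px | here refl = ⊥-elim (¬Px Py)
  ... | no _ | there y∈xs = find-complete P? y∈xs Py

  find-cong : {P Q : Pred A 0ℓ} (P? : Decidable P) (Q? : Decidable Q) (xs : List A) →
              (∀ {x} → x ∈ xs → P x ⇔ Q x) → find P? xs ≡ find Q? xs
  find-cong P? Q? [] _ = refl
  find-cong P? Q? (x ∷ xs) P⇔Q rewrite does-⇔ (P⇔Q (here refl)) (P? x) (Q? x) =
    cong (if does (Q? x) then just x else_) (find-cong P? Q? xs (P⇔Q ∘ there))

-- Reading the tree off the term operation

Extensional : Pred (Assignment n → Bool) 0ℓ
Extensional φ = ∀ {ρ σ} → (∀ x → ρ x ≡ σ x) → φ ρ ≡ φ σ

eval-extensional : (t : Term n) → Extensional (eval t)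
eval-extensional t ρ≗σ = eval-cong t (λ {x} _ → ρ≗σ x)

∀-assignment? : {P : Pred (Assignment n) 0ℓ} → (∀ {ρ σ} → (∀ x → ρ x ≡ σ x) → P ρ → P σ) →
                Decidable P → Dec (∀ ρ → P ρ)
∀-assignment? {zero} resp P? = map′ (λ P₀ ρ → resp (λ ()) P₀) (λ ∀P → ∀P (const false)) (P? (const false))
∀-assignment? {suc n} {P} resp P? =
  map′ (λ (P-false , P-true) ρ → resp (head◂tail ρ) (by-head P-false P-true (ρ zero) (tailᵥ ρ)))
       (λ ∀P → (λ σ → ∀P (false ◂ σ)) , (λ σ → ∀P (true ◂ σ)))
       (∀-assignment? (λ ρ≗σ → resp (◂-cong ρ≗σ)) (λ σ → P? (false ◂ σ)) ×-dec
        ∀-assignment? (λ ρ≗σ → resp (◂-cong ρ≗σ)) (λ σ → P? (true ◂ σ)))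
  where
  head◂tail : (ρ : Assignment (suc n)) → ∀ x → (ρ zero ◂ tailᵥ ρ) x ≡ ρ x
  head◂tail ρ zero = refl
  head◂tail ρ (suc x) = refl
  ◂-cong : {b : Bool} {ρ σ : Assignment n} → (∀ x → ρ x ≡ σ x) → ∀ x → (b ◂ ρ) x ≡ (b ◂ σ) x
  ◂-cong ρ≗σ zero = refl
  ◂-cong ρ≗σ (suc x) = ρ≗σ x
  by-head : (∀ σ → P (false ◂ σ)) → (∀ σ → P (true ◂ σ)) → ∀ b σ → P (b ◂ σ)
  by-head P-false _ false = P-false
  by-head _ P-true true = P-true

semanticLeaf? : {φ : Assignment n → Bool} → Extensional φ → (ℓ p : Fin n) → Dec (SemanticLeaf φ ℓ p)
semanticLeaf? {φ = φ} φ-ext ℓ p =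
  ∀-assignment? respects (λ ρ → (ρ ℓ ≟ᵇ false) →-dec (φ ρ ≟ᵇ φ (raise ℓ p ρ)))
  where
  respects : ∀ {ρ σ} → (∀ x → ρ x ≡ σ x) →
         (ρ ℓ ≡ false → φ ρ ≡ φ (raise ℓ p ρ)) → σ ℓ ≡ false → φ σ ≡ φ (raise ℓ p σ)
  respects ρ≗σ H σℓ = trans (sym (φ-ext ρ≗σ))
    (trans (H (trans (ρ≗σ ℓ) σℓ)) (φ-ext (λ x → raise-cong ℓ p (ρ≗σ x))))

parentOf : {φ : Assignment n → Bool} → Extensional φ → Fin n → Maybe (Fin n)
parentOf φ-ext ℓ = find (semanticLeaf? φ-ext ℓ) (allFin _)

isLeaf? : {φ : Assignment n → Bool} → Extensional φ → Decidable (λ ℓ → ∃ (SemanticLeaf φ ℓ))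
isLeaf? φ-ext ℓ = any? (semanticLeaf? φ-ext ℓ)

prune : Fin n → (Assignment n → Bool) → Assignment n → Bool
prune ℓ φ ρ = φ (ρ [ ℓ ≔ true ])

prune-extensional : {φ : Assignment n → Bool} (ℓ : Fin n) → Extensional φ → Extensional (prune ℓ φ)
prune-extensional ℓ φ-ext ρ≗σ = φ-ext (λ x → ≔-cong ℓ (ρ≗σ x))

pruferCode : List (Fin n) → {φ : Assignment n → Bool} → Extensional φ → ℕ → List (Fin n)
pruferCode V φ-ext zero = []
pruferCode V φ-ext (suc k) with find (isLeaf? φ-ext) V
... | nothing = []
... | just ℓ with parentOf φ-ext ℓ
...   | nothing = []
...   | just p = p ∷ pruferCode (remove ℓ V) (prune-extensional ℓ φ-ext) k

_∉?_ : (x : Fin n) (s : List (Fin n)) → Dec (x ∉ s)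
x ∉? s = ¬? (Any.any? (x ≟_) s)

-- The default variable d is only used on inputs that are not codes.
decode : Fin n → List (Fin n) → List (Fin n) → Term n
decode d V (a ∷ s) with find (_∉? (a ∷ s)) V
... | nothing = var d
... | just ℓ = attach a ℓ (decode d (remove ℓ V) s)
decode d [] [] = var d
decode d (x ∷ _) [] = var x

IsLeaf : Term n → Fin n → Set
IsLeaf t x = ∃ (Leaf t x)

semanticLeaf-cong : {φ ψ : Assignment n → Bool} → (∀ ρ → φ ρ ≡ ψ ρ) → {ℓ p : Fin n} →
                    SemanticLeaf φ ℓ p ⇔ SemanticLeaf ψ ℓ p
semanticLeaf-cong φ≗ψ = mk⇔ (λ H ρ ρℓ → trans (sym (φ≗ψ ρ)) (trans (H ρ ρℓ) (φ≗ψ _)))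
                            (λ H ρ ρℓ → trans (φ≗ψ ρ) (trans (H ρ ρℓ) (sym (φ≗ψ _))))

∃semanticLeaf⇔isLeaf : {t : Term n} {x : Fin n} → Linear t → x ∈ₜ t → ∃ (SemanticLeaf (eval t) x) ⇔ IsLeaf t x
∃semanticLeaf⇔isLeaf lin x∈t = mk⇔ (λ (p , H) → p , semanticLeaf⇒leaf lin x∈t H)
                                  (λ (p , L) → p , leaf⇒semanticLeaf lin L)

parentOf-leaf : {t : Term n} {x p : Fin n} → Linear t → Leaf t x p → parentOf (eval-extensional t) x ≡ just p
parentOf-leaf {t = t} {x} {p} lin L =
  trans found (cong just (leaf-unique lin (semanticLeaf⇒leaf lin (leaf∈ₜ L) z-semLeaf) L))
  where
  search = find-complete (semanticLeaf? (eval-extensional t) x) (∈-allFin p) (leaf⇒semanticLeaf lin L)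
  found = proj₂ search
  z-semLeaf = proj₁ (find-sound (semanticLeaf? (eval-extensional t) x) (allFin _) found)

∃semanticLeaf-cong : {φ ψ : Assignment n → Bool} → (∀ ρ → φ ρ ≡ ψ ρ) → {ℓ : Fin n} →
                     ∃ (SemanticLeaf φ ℓ) ⇔ ∃ (SemanticLeaf ψ ℓ)
∃semanticLeaf-cong φ≗ψ = mk⇔ (λ (p , H) → p , Equivalence.to (semanticLeaf-cong φ≗ψ) H)
                             (λ (p , H) → p , Equivalence.from (semanticLeaf-cong φ≗ψ) H)

pruferCode-cong : (V : List (Fin n)) {φ ψ : Assignment n → Bool} (φ-ext : Extensional φ) (ψ-ext : Extensional ψ)
                  (k : ℕ) → (∀ ρ → φ ρ ≡ ψ ρ) → pruferCode V φ-ext k ≡ pruferCode V ψ-ext k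
pruferCode-cong V φ-ext ψ-ext zero _ = refl
pruferCode-cong V φ-ext ψ-ext (suc k) φ≗ψ
  rewrite find-cong (isLeaf? φ-ext) (isLeaf? ψ-ext) V (λ _ → ∃semanticLeaf-cong φ≗ψ)
  with find (isLeaf? ψ-ext) V
... | nothing = refl
... | just ℓ
  rewrite find-cong (semanticLeaf? φ-ext ℓ) (semanticLeaf? ψ-ext ℓ) (allFin _) (λ _ → semanticLeaf-cong φ≗ψ)
  with parentOf ψ-ext ℓ
...   | nothing = refl
...   | just p = cong (p ∷_) (pruferCode-cong (remove ℓ V) _ _ k (λ ρ → φ≗ψ (ρ [ ℓ ≔ true ])))

pruferCode-step : (V : List (Fin n)) {φ : Assignment n → Bool} (φ-ext : Extensional φ) {k : ℕ} {ℓ p : Fin n} →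
                  find (isLeaf? φ-ext) V ≡ just ℓ → parentOf φ-ext ℓ ≡ just p →
                  pruferCode V φ-ext (suc k) ≡ p ∷ pruferCode (remove ℓ V) (prune-extensional ℓ φ-ext) k
pruferCode-step V φ-ext found parent rewrite found | parent = refl

record TreeOn (t : Term n) (V : List (Fin n)) : Set where
  field
    linear : Linear t
    unique : Unique V
    vars⊆ : ∀ {x} → x ∈ₜ t → x ∈ V
    vars⊇ : ∀ {x} → x ∈ V → x ∈ₜ t

open TreeOn

TreeOn-detach : {t : Term n} {V : List (Fin n)} {ℓ p : Fin n} → TreeOn t V → Leaf t ℓ p →
                TreeOn (detach ℓ t) (remove ℓ V)
TreeOn-detach {t = t} {V} {ℓ} T L = record
  { linear = detach-linear ℓ (linear T)
  ; unique = remove-unique ℓ (unique T)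
  ; vars⊆ = λ x∈ → ∈-remove⁺ ℓ (vars⊆ T (∈-detach⁻ ℓ t x∈)) (∈-detach⇒≢ ℓ (linear T) L x∈)
  ; vars⊇ = λ x∈ → let x∈V , x≢ℓ = ∈-remove⁻ ℓ x∈ in ∈-detach⁺ ℓ t (vars⊇ T x∈V) x≢ℓ
  }

length-removeLeaf : {t : Term n} {V : List (Fin n)} {ℓ p : Fin n} {k : ℕ} → TreeOn t V → Leaf t ℓ p →
                length V ≡ suc k → length (remove ℓ V) ≡ k
length-removeLeaf T L |V| = suc-injective (trans (length-remove _ (vars⊆ T (leaf∈ₜ L)) (unique T)) |V|)

record FirstLeaf (t : Term n) (V : List (Fin n)) : Set where
  field
    leaf parent : Fin n
    isLeaf : Leaf t leaf parent
    found : find (isLeaf? (eval-extensional t)) V ≡ just leaf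

firstLeaf : {t : Term n} {V : List (Fin n)} {k : ℕ} → TreeOn t V → length V ≡ suc (suc k) → FirstLeaf t V
firstLeaf {t = var y} {v₁ ∷ v₂ ∷ _} T _ with vars⊇ T (here refl) | vars⊇ T (there (here refl)) | unique T
... | var∈ | var∈ | v₁∉ ∷ _ = ⊥-elim (All.head v₁∉ refl)
firstLeaf {t = s · u} {V} T _ = record
  { leaf = ℓ ; parent = proj₁ semLeaf
  ; isLeaf = semanticLeaf⇒leaf (linear T) (vars⊇ T ℓ∈V) (proj₂ semLeaf)
  ; found = found
  }
  where
  someLeaf = compound-hasLeaf s u
  L₀ = proj₂ (proj₂ someLeaf)
  search = find-complete (isLeaf? (eval-extensional (s · u))) (vars⊆ T (leaf∈ₜ L₀))
                         (_ , leaf⇒semanticLeaf (linear T) L₀)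
  ℓ = proj₁ search
  found = proj₂ search
  semLeaf = proj₁ (find-sound (isLeaf? (eval-extensional (s · u))) V found)
  ℓ∈V = proj₂ (find-sound (isLeaf? (eval-extensional (s · u))) V found)

pruferCode-detach : {t : Term n} {V : List (Fin n)} {k : ℕ} → TreeOn t V → (F : FirstLeaf t V) →
                    let open FirstLeaf F in
                    pruferCode V (eval-extensional t) (suc k) ≡
                    parent ∷ pruferCode (remove leaf V) (eval-extensional (detach leaf t)) k
pruferCode-detach {t = t} {V} {k} T F =
  trans (pruferCode-step V (eval-extensional t) found (parentOf-leaf (linear T) isLeaf))
        (cong (parent ∷_) (pruferCode-cong (remove leaf V) _ _ k (λ ρ → sym (eval-detach leaf (linear T) isLeaf ρ))))
  where open FirstLeaf F

pruferCode-length : {t : Term n} {V : List (Fin n)} (k : ℕ) → TreeOn t V → length V ≡ suc k →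
                    length (pruferCode V (eval-extensional t) k) ≡ k
pruferCode-length zero _ _ = refl
pruferCode-length (suc k) T |V| =
  trans (cong length (pruferCode-detach T F))
        (cong suc (pruferCode-length k (TreeOn-detach T isLeaf) (length-removeLeaf T isLeaf |V|)))
  where
  F = firstLeaf T |V|
  open FirstLeaf F

∈-pruferCode⁻ : {t : Term n} {V : List (Fin n)} (k : ℕ) → TreeOn t V → length V ≡ suc k → {x : Fin n} →
                x ∈ pruferCode V (eval-extensional t) k → x ∈ V × ¬ IsLeaf t x
∈-pruferCode⁻ {t = t} {V} (suc k) T |V| {x} x∈ = from-step (subst (x ∈_) (pruferCode-detach T F) x∈)
  where
  F = firstLeaf T |V|
  open FirstLeaf F
  from-step : x ∈ parent ∷ pruferCode (remove leaf V) (eval-extensional (detach leaf t)) k → x ∈ V × ¬ IsLeaf t x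
  from-step (here refl) = vars⊆ T (parent∈ₜ isLeaf) , λ (_ , K) → parent-notLeaf (linear T) isLeaf K
  from-step (there x∈′) with ∈-pruferCode⁻ k (TreeOn-detach T isLeaf) (length-removeLeaf T isLeaf |V|) x∈′
  ... | x∈V′ , notLeaf′ with ∈-remove⁻ leaf {V} x∈V′
  ...   | x∈V , x≢leaf = x∈V , λ (q , K) → notLeaf′ (q , detach-keepsLeaf leaf (linear T) isLeaf K x≢leaf)

∈-pruferCode⁺ : {t : Term n} {V : List (Fin n)} (k : ℕ) → TreeOn t V → length V ≡ suc (suc k) → {x : Fin n} →
                x ∈ V → ¬ IsLeaf t x → x ∈ pruferCode V (eval-extensional t) (suc k)

∈-pruferCode-≢⁺ : {t : Term n} {V : List (Fin n)} (k : ℕ) → TreeOn t V → length V ≡ suc k → {x y : Fin n} →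
                  x ∈ V → y ∈ V → x ≢ y → ¬ IsLeaf t x → x ∈ pruferCode V (eval-extensional t) k
∈-pruferCode-≢⁺ zero T |V| x∈V y∈V x≢y _ = ⊥-elim (x≢y (length≡1⇒∈-unique |V| x∈V y∈V))
∈-pruferCode-≢⁺ (suc k) T |V| x∈V _ _ notLeaf = ∈-pruferCode⁺ k T |V| x∈V notLeaf

∈-pruferCode⁺ {t = t} {V} k T |V| {x} x∈V notLeaf with x ≟ FirstLeaf.parent (firstLeaf T |V|)
... | yes refl = subst (x ∈_) (sym (pruferCode-detach T (firstLeaf T |V|))) (here refl)
... | no x≢p = subst (x ∈_) (sym (pruferCode-detach T F))
  (there (∈-pruferCode-≢⁺ k (TreeOn-detach T isLeaf) (length-removeLeaf T isLeaf |V|) x∈V′ p∈V′ x≢p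
           (λ (q , K) → notLeaf (q , detach-leaf⁻ leaf (linear T) isLeaf K x≢p))))
  where
  F = firstLeaf T |V|
  open FirstLeaf F
  x∈V′ = ∈-remove⁺ leaf x∈V (λ { refl → notLeaf (parent , isLeaf) })
  p∈V′ = ∈-remove⁺ leaf (vars⊆ T (parent∈ₜ isLeaf)) (parent≢leaf (linear T) isLeaf)

record CodeOn (V s : List (Fin n)) : Set where
  field
    distinct : Unique V
    length≡ : length V ≡ suc (length s)
    entries∈ : All (_∈ V) s

open CodeOn

record FirstAbsent (V : List (Fin n)) (s : List (Fin n)) : Set where
  field
    absent : Fin n
    found : find (_∉? s) V ≡ just absent
    absent∈V : absent ∈ V
    absent∉s : absent ∉ s

firstAbsent : {V : List (Fin n)} {s : List (Fin n)} → CodeOn V s → FirstAbsent V s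
firstAbsent {V = V} {s} cw = record
  { absent = proj₁ search ; found = proj₂ search
  ; absent∈V = proj₂ (find-sound (_∉? s) V (proj₂ search))
  ; absent∉s = proj₁ (find-sound (_∉? s) V (proj₂ search))
  }
  where
  missing = unique-longer-notCovered s (distinct cw) (subst (suc (length s) ≤_) (sym (length≡ cw)) ≤-refl)
  search = find-complete (_∉? s) (proj₁ (proj₂ missing)) (proj₂ (proj₂ missing))

decode-∷ : (d : Fin n) (V : List (Fin n)) {a ℓ : Fin n} {s : List (Fin n)} → find (_∉? (a ∷ s)) V ≡ just ℓ →
           decode d V (a ∷ s) ≡ attach a ℓ (decode d (remove ℓ V) s)
decode-∷ d V found rewrite found = refl

CodeOn-remove : {V : List (Fin n)} {a ℓ : Fin n} {s : List (Fin n)} → CodeOn V (a ∷ s) → ℓ ∈ V → ℓ ∉ a ∷ s →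
                CodeOn (remove ℓ V) s
CodeOn-remove {ℓ = ℓ} cw ℓ∈V ℓ∉ = record
  { distinct = remove-unique ℓ (distinct cw)
  ; length≡ = suc-injective (trans (length-remove ℓ ℓ∈V (distinct cw)) (length≡ cw))
  ; entries∈ = All.tabulate λ y∈s → ∈-remove⁺ ℓ (All.lookup (entries∈ cw) (there y∈s)) (λ { refl → ℓ∉ (there y∈s) })
  }

decode-tree : (d : Fin n) {V s : List (Fin n)} → CodeOn V s → TreeOn (decode d V s) V
decode-tree d {V} {a ∷ s} cw = subst (λ t → TreeOn t V) (sym (decode-∷ d V found)) (record
  { linear = attach-linear a ℓ (linear T′) (λ ℓ∈U → proj₂ (∈-remove⁻ ℓ {V} (vars⊆ T′ ℓ∈U)) refl)
  ; unique = distinct cw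
  ; vars⊆ = vars⊆′
  ; vars⊇ = vars⊇′
  })
  where
  open FirstAbsent (firstAbsent cw) renaming (absent to ℓ)
  U = decode d (remove ℓ V) s
  T′ = decode-tree d (CodeOn-remove cw absent∈V absent∉s)
  a∈U : a ∈ₜ U
  a∈U = vars⊇ T′ (∈-remove⁺ ℓ (All.head (entries∈ cw)) (λ a≡ℓ → absent∉s (here (sym a≡ℓ))))
  vars⊆′ : ∀ {x} → x ∈ₜ attach a ℓ U → x ∈ V
  vars⊆′ x∈ with ∈-attach⁻ a ℓ U x∈
  ... | inj₁ x∈U = proj₁ (∈-remove⁻ ℓ (vars⊆ T′ x∈U))
  ... | inj₂ (refl , _) = absent∈V
  vars⊇′ : ∀ {x} → x ∈ V → x ∈ₜ attach a ℓ U
  vars⊇′ {x} x∈V with x ≟ ℓ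
  ... | yes refl = leaf∈ₜ (attach-leaf a ℓ U a∈U)
  ... | no x≢ℓ = ∈-attach⁺ a ℓ U (vars⊇ T′ (∈-remove⁺ ℓ x∈V x≢ℓ))
decode-tree d {v ∷ []} {[]} cw = record
  { linear = var ; unique = distinct cw
  ; vars⊆ = λ { var∈ → here refl } ; vars⊇ = λ { (here refl) → var∈ } }
decode-tree d {[]} {[]} cw with length≡ cw
... | ()
decode-tree d {_ ∷ _ ∷ _} {[]} cw with length≡ cw
... | ()

attach-isLeaf⇔ : (a ℓ : Fin n) {t : Term n} → a ∈ₜ t → {x : Fin n} →
                 IsLeaf (attach a ℓ t) x ⇔ (x ≡ ℓ ⊎ (IsLeaf t x × x ≢ a))
attach-isLeaf⇔ a ℓ {t} a∈t = mk⇔ to from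
  where
  to : ∀ {x} → IsLeaf (attach a ℓ t) x → x ≡ ℓ ⊎ (IsLeaf t x × x ≢ a)
  to (q , L) with attach-leaf⁻ a ℓ t L
  ... | inj₁ (x≡ℓ , _) = inj₁ x≡ℓ
  ... | inj₂ (L′ , x≢a) = inj₂ ((q , L′) , x≢a)
  from : ∀ {x} → x ≡ ℓ ⊎ (IsLeaf t x × x ≢ a) → IsLeaf (attach a ℓ t) x
  from (inj₁ refl) = a , attach-leaf a ℓ t a∈t
  from (inj₂ ((q , L) , x≢a)) = q , attach-keepsLeaf a ℓ L x≢a

decode-[]-noLeaf : (d : Fin n) (V : List (Fin n)) {x : Fin n} → ¬ IsLeaf (decode d V []) x
decode-[]-noLeaf d [] (_ , ())
decode-[]-noLeaf d (_ ∷ _) (_ , ())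

decode-leaves : (d : Fin n) {V : List (Fin n)} {a : Fin n} {s : List (Fin n)} → CodeOn V (a ∷ s) → {x : Fin n} →
                IsLeaf (decode d V (a ∷ s)) x ⇔ (x ∈ V × x ∉ a ∷ s)

decode-leaves-except : (d : Fin n) {W s : List (Fin n)} → CodeOn W s → {a : Fin n} → a ∈ W → {x : Fin n} →
                       (IsLeaf (decode d W s) x × x ≢ a) ⇔ (x ∈ W × x ∉ s × x ≢ a)
decode-leaves-except d {W} {[]} cw a∈W =
  mk⇔ (λ (leaf , _) → ⊥-elim (decode-[]-noLeaf d W leaf))
      (λ (x∈W , _ , x≢a) → ⊥-elim (x≢a (length≡1⇒∈-unique (length≡ cw) x∈W a∈W)))
decode-leaves-except d {W} {b ∷ s} cw a∈W =
  mk⇔ (λ (leaf , x≢a) → let x∈W , x∉ = Equivalence.to (decode-leaves d cw) leaf in x∈W , x∉ , x≢a)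
      (λ (x∈W , x∉ , x≢a) → Equivalence.from (decode-leaves d cw) (x∈W , x∉) , x≢a)

decode-leaves d {V} {a} {s} cw {x} =
  subst (λ t → IsLeaf t x ⇔ (x ∈ V × x ∉ a ∷ s)) (sym (decode-∷ d V found)) (mk⇔ to from)
  where
  open FirstAbsent (firstAbsent cw) renaming (absent to ℓ)
  U = decode d (remove ℓ V) s
  a∈V′ : a ∈ remove ℓ V
  a∈V′ = ∈-remove⁺ ℓ (All.head (entries∈ cw)) (λ a≡ℓ → absent∉s (here (sym a≡ℓ)))
  leavesOfU = decode-leaves-except d (CodeOn-remove cw absent∈V absent∉s) a∈V′
  attached = attach-isLeaf⇔ a ℓ (vars⊇ (decode-tree d (CodeOn-remove cw absent∈V absent∉s)) a∈V′)
  to : IsLeaf (attach a ℓ U) x → x ∈ V × x ∉ a ∷ s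
  to leaf with Equivalence.to attached leaf
  ... | inj₁ refl = absent∈V , absent∉s
  ... | inj₂ leaf′ with Equivalence.to leavesOfU leaf′
  ...   | x∈V′ , x∉s , x≢a = proj₁ (∈-remove⁻ ℓ x∈V′) , λ { (here x≡a) → x≢a x≡a ; (there x∈s) → x∉s x∈s }
  from : x ∈ V × x ∉ a ∷ s → IsLeaf (attach a ℓ U) x
  from (x∈V , x∉) with x ≟ ℓ
  ... | yes x≡ℓ = Equivalence.from attached (inj₁ x≡ℓ)
  ... | no x≢ℓ = Equivalence.from attached
        (inj₂ (Equivalence.from leavesOfU (∈-remove⁺ ℓ x∈V x≢ℓ , x∉ ∘ there , x∉ ∘ here)))

eval-attach-pruned : (a ℓ : Fin n) {u : Term n} → ℓ ∉ₜ u → a ≢ ℓ → (ρ : Assignment n) →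
                     eval (attach a ℓ u) (ρ [ ℓ ≔ true ]) ≡ eval u ρ
eval-attach-pruned a ℓ {u} ℓ∉u a≢ℓ ρ = trans (eval-attach a ℓ u σ) (eval-cong u agree)
  where
  σ = ρ [ ℓ ≔ true ]
  agree : ∀ {x} → x ∈ₜ u → (σ [ a ≔ (σ ℓ ⇒ σ a) ]) x ≡ ρ x
  agree {x} x∈u with x ≟ a
  ... | yes refl = begin
    (σ [ x ≔ (σ ℓ ⇒ σ x) ]) x   ≡⟨ ≔-same σ x ⟩
    (σ ℓ ⇒ σ x)                 ≡⟨ cong (_⇒ σ x) (≔-same ρ ℓ) ⟩
    (true ⇒ σ x)                ≡⟨ true⇒ (σ x) ⟩
    σ x                         ≡⟨ ≔-other ρ a≢ℓ ⟩
    ρ x                         ∎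
    where open ≡-Reasoning
  ... | no x≢a = trans (≔-other σ x≢a) (≔-other ρ (λ { refl → ℓ∉u x∈u }))

pruferCode-decode : (d : Fin n) {V s : List (Fin n)} → CodeOn V s →
                    pruferCode V (eval-extensional (decode d V s)) (length s) ≡ s
pruferCode-decode d {V} {[]} cw = refl
pruferCode-decode d {V} {a ∷ s} cw =
  subst (λ t → pruferCode V (eval-extensional t) (suc (length s)) ≡ a ∷ s) (sym (decode-∷ d V found)) (begin
    pruferCode V (eval-extensional T) (suc (length s))
      ≡⟨ pruferCode-step V (eval-extensional T) leafFound (parentOf-leaf (linear tree) (attach-leaf a ℓ U a∈U)) ⟩
    a ∷ pruferCode (remove ℓ V) (prune-extensional ℓ (eval-extensional T)) (length s)
      ≡⟨ cong (a ∷_) (pruferCode-cong (remove ℓ V) _ (eval-extensional U) (length s)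
                        (eval-attach-pruned a ℓ ℓ∉U a≢ℓ)) ⟩
    a ∷ pruferCode (remove ℓ V) (eval-extensional U) (length s)
      ≡⟨ cong (a ∷_) (pruferCode-decode d cw′) ⟩
    a ∷ s ∎)
  where
  open ≡-Reasoning
  open FirstAbsent (firstAbsent cw) renaming (absent to ℓ)
  cw′ = CodeOn-remove cw absent∈V absent∉s
  U = decode d (remove ℓ V) s
  T = attach a ℓ U
  U-tree = decode-tree d cw′
  tree : TreeOn T V
  tree = subst (λ t → TreeOn t V) (decode-∷ d V found) (decode-tree d cw)
  a≢ℓ : a ≢ ℓ
  a≢ℓ a≡ℓ = absent∉s (here (sym a≡ℓ))
  a∈U : a ∈ₜ U
  a∈U = vars⊇ U-tree (∈-remove⁺ ℓ (All.head (entries∈ cw)) a≢ℓ)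
  ℓ∉U : ℓ ∉ₜ U
  ℓ∉U ℓ∈U = proj₂ (∈-remove⁻ ℓ {V} (vars⊆ U-tree ℓ∈U)) refl
  leavesOfT : ∀ {x} → IsLeaf T x ⇔ (x ∈ V × x ∉ a ∷ s)
  leavesOfT {x} = subst (λ t → IsLeaf t x ⇔ (x ∈ V × x ∉ a ∷ s)) (decode-∷ d V found) (decode-leaves d cw)
  leaves⇔ : ∀ {x} → x ∈ V → ∃ (SemanticLeaf (eval T) x) ⇔ (x ∉ a ∷ s)
  leaves⇔ x∈V = mk⇔
    (λ semLeaf → proj₂ (Equivalence.to leavesOfT (Equivalence.to isLeaf⇔ semLeaf)))
    (λ x∉ → Equivalence.from isLeaf⇔ (Equivalence.from leavesOfT (x∈V , x∉)))
    where isLeaf⇔ = ∃semanticLeaf⇔isLeaf (linear tree) (vars⊇ tree x∈V)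
  leafFound : find (isLeaf? (eval-extensional T)) V ≡ just ℓ
  leafFound = trans (find-cong (isLeaf? (eval-extensional T)) (_∉? (a ∷ s)) V leaves⇔) found

reattach-sameOp : {t : Term n} {ℓ p : Fin n} → Linear t → Leaf t ℓ p → (D : Term n) →
                  SameOp _⇐_ D (detach ℓ t) → SameOp _⇐_ (attach p ℓ D) t
reattach-sameOp {t = t} {ℓ} {p} lin L D D≈ ρ = begin
  eval (attach p ℓ D) ρ       ≡⟨ eval-attach p ℓ D ρ ⟩
  eval D σ                    ≡⟨ D≈ σ ⟩
  eval (detach ℓ t) σ         ≡⟨ eval-detach ℓ lin L σ ⟩
  eval t (σ [ ℓ ≔ true ])     ≡⟨ by-leafValue (ρ ℓ) refl ⟩
  eval t ρ                    ∎
  where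
  open ≡-Reasoning
  σ = ρ [ p ≔ (ρ ℓ ⇒ ρ p) ]
  p≢ℓ = parent≢leaf lin L
  by-leafValue : (b : Bool) → ρ ℓ ≡ b → eval t (σ [ ℓ ≔ true ]) ≡ eval t ρ
  by-leafValue true ρℓ = eval-cong t λ {x} _ → pointwise x
    where
    pointwise : ∀ x → (σ [ ℓ ≔ true ]) x ≡ ρ x
    pointwise x with x ≟ ℓ | x ≟ p
    ... | yes refl | _ = trans (≔-same σ x) (sym ρℓ)
    ... | no x≢ℓ | yes refl = trans (≔-other σ x≢ℓ) (trans (≔-same ρ x) (trans (cong (_⇒ ρ x) ρℓ) (true⇒ (ρ x))))
    ... | no x≢ℓ | no x≢p = trans (≔-other σ x≢ℓ) (≔-other ρ x≢p)
  by-leafValue false ρℓ = trans (eval-cong t λ {x} _ → pointwise x) (sym (leaf⇒semanticLeaf lin L ρ ρℓ))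
    where
    pointwise : ∀ x → (σ [ ℓ ≔ true ]) x ≡ raise ℓ p ρ x
    pointwise x with x ≟ ℓ | x ≟ p
    ... | yes refl | _ = trans (≔-same σ x) (sym (raise-leaf ρ x p))
    ... | no x≢ℓ | yes refl = trans (≔-other σ x≢ℓ) (trans (≔-same ρ x) (trans (cong (_⇒ ρ x) ρℓ) (sym (raise-parent ρ ℓ x))))
    ... | no x≢ℓ | no x≢p = trans (≔-other σ x≢ℓ) (trans (≔-other ρ x≢p) (sym (raise-other ρ x≢ℓ x≢p)))

singleVertex-tree : {t : Term n} {V : List (Fin n)} → TreeOn t V → length V ≡ 1 → ∃ λ v → V ≡ v ∷ [] × t ≡ var v
singleVertex-tree {t = var y} {v ∷ []} T _ with vars⊆ T var∈
... | here refl = y , refl , refl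
singleVertex-tree {t = s · u} {V} T |V| with linear T
... | _ · _ ⟨ s#u ⟩ = ⊥-elim (Disjointₜ⇒≢ s#u (headVar∈ s) (headVar∈ u)
       (length≡1⇒∈-unique |V| (vars⊆ T (·∈ˡ (headVar∈ s))) (vars⊆ T (·∈ʳ (headVar∈ u)))))

decode-pruferCode : (d : Fin n) {t : Term n} {V : List (Fin n)} (k : ℕ) → TreeOn t V → length V ≡ suc k →
                    SameOp _⇐_ (decode d V (pruferCode V (eval-extensional t) k)) t
decode-pruferCode d zero T |V| with singleVertex-tree T |V|
... | v , refl , refl = λ _ → refl
decode-pruferCode d {t} {V} (suc k) T |V| =
  subst (λ c → SameOp _⇐_ (decode d V c) t) (sym (pruferCode-detach T F))
    (subst (λ u → SameOp _⇐_ u t) (sym (decode-∷ d V absentFound))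
      (reattach-sameOp (linear T) isLeaf D
        (decode-pruferCode d k (TreeOn-detach T isLeaf) (length-removeLeaf T isLeaf |V|))))
  where
  F = firstLeaf T |V|
  open FirstLeaf F
  code′ = pruferCode (remove leaf V) (eval-extensional (detach leaf t)) k
  D = decode d (remove leaf V) code′
  notInCode⇔leaf : ∀ {x} → x ∈ V → (x ∉ parent ∷ code′) ⇔ ∃ (SemanticLeaf (eval t) x)
  notInCode⇔leaf {x} x∈V = mk⇔
    (λ x∉ → decidable-stable (isLeaf? (eval-extensional t) x) λ notLeaf →
       x∉ (subst (x ∈_) (pruferCode-detach T F)
             (∈-pruferCode⁺ k T |V| x∈V (notLeaf ∘ Equivalence.from (∃semanticLeaf⇔isLeaf (linear T) (vars⊇ T x∈V))))))
    (λ semLeaf x∈ → proj₂ (∈-pruferCode⁻ (suc k) T |V| (subst (x ∈_) (sym (pruferCode-detach T F)) x∈))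
                      (Equivalence.to (∃semanticLeaf⇔isLeaf (linear T) (vars⊇ T x∈V)) semLeaf))
  absentFound : find (_∉? (parent ∷ code′)) V ≡ just leaf
  absentFound = trans (find-cong (_∉? (parent ∷ code′)) (isLeaf? (eval-extensional t)) V notInCode⇔leaf) found

-- Counting full linear terms

module Digits (N : ℕ) where

  digits : (k : ℕ) → Fin (N ^ k) → List (Fin N)
  digits zero _ = []
  digits (suc k) i = proj₁ (remQuot {N} (N ^ k) i) ∷ digits k (proj₂ (remQuot {N} (N ^ k) i))

  length-digits : (k : ℕ) (i : Fin (N ^ k)) → length (digits k i) ≡ k
  length-digits zero _ = refl
  length-digits (suc k) i = cong suc (length-digits k _)

  digits-injective : (k : ℕ) {i j : Fin (N ^ k)} → digits k i ≡ digits k j → i ≡ j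
  digits-injective zero {zero} {zero} _ = refl
  digits-injective (suc k) {i} {j} eq with ∷-injective eq
  ... | high≡ , low≡ = begin
    i                                            ≡⟨ sym (combine-remQuot {N} (N ^ k) i) ⟩
    uncurry combine (remQuot {N} (N ^ k) i)      ≡⟨ cong₂ combine high≡ (digits-injective k low≡) ⟩
    uncurry combine (remQuot {N} (N ^ k) j)      ≡⟨ combine-remQuot {N} (N ^ k) j ⟩
    j                                            ∎
    where open ≡-Reasoning

  digits-surjective : (k : ℕ) (s : List (Fin N)) → length s ≡ k → ∃ λ i → digits k i ≡ s
  digits-surjective zero [] _ = zero , refl
  digits-surjective (suc k) (a ∷ s) |s| with digits-surjective k s (suc-injective |s|)
  ... | j , digits≡s = combine a j , cong₂ _∷_ (cong proj₁ split) (trans (cong (digits k ∘ proj₂) split) digits≡s)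
    where split = remQuot-combine {N} {N ^ k} a j

∈ₜ⇒∈leaves : {x : Fin n} (t : Term n) → x ∈ₜ t → x ∈ leaves t
∈ₜ⇒∈leaves (var y) var∈ = here refl
∈ₜ⇒∈leaves (s · u) (·∈ˡ x∈s) = ∈-++⁺ˡ (∈ₜ⇒∈leaves s x∈s)
∈ₜ⇒∈leaves (s · u) (·∈ʳ x∈u) = ∈-++⁺ʳ (leaves s) (∈ₜ⇒∈leaves u x∈u)

∈leaves⇒∈ₜ : {x : Fin n} (t : Term n) → x ∈ leaves t → x ∈ₜ t
∈leaves⇒∈ₜ (var y) (here refl) = var∈
∈leaves⇒∈ₜ (s · u) x∈ with ∈-++⁻ (leaves s) x∈
... | inj₁ x∈s = ·∈ˡ (∈leaves⇒∈ₜ s x∈s)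
... | inj₂ x∈u = ·∈ʳ (∈leaves⇒∈ₜ u x∈u)

unique-++⁻ : {A : Set} (xs : List A) {ys : List A} → Unique (xs ++ ys) →
             Unique xs × Unique ys × (∀ {x} → x ∈ xs → x ∈ ys → ⊥)
unique-++⁻ [] ys! = [] , ys! , λ ()
unique-++⁻ (x ∷ xs) (x∉ ∷ rest!) with unique-++⁻ xs rest!
... | xs! , ys! , disjoint = Allₚ.++⁻ˡ xs x∉ ∷ xs! , ys! ,
  λ { (here refl) x∈ys → All.lookup (Allₚ.++⁻ʳ xs x∉) x∈ys refl ; (there x∈xs) → disjoint x∈xs }

linear⇒unique : {t : Term n} → Linear t → Unique (leaves t)
linear⇒unique var = [] ∷ []
linear⇒unique {t = s · u} (lin-s · lin-u ⟨ s#u ⟩) =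
  Unique.++⁺ (linear⇒unique lin-s) (linear⇒unique lin-u)
             (λ (x∈s , x∈u) → s#u (∈leaves⇒∈ₜ s x∈s) (∈leaves⇒∈ₜ u x∈u))

unique⇒linear : (t : Term n) → Unique (leaves t) → Linear t
unique⇒linear (var x) _ = var
unique⇒linear (s · u) s++u! with unique-++⁻ (leaves s) s++u!
... | s! , u! , disjoint = unique⇒linear s s! · unique⇒linear u u! ⟨ (λ x∈s x∈u → disjoint (∈ₜ⇒∈leaves s x∈s) (∈ₜ⇒∈leaves u x∈u)) ⟩

fullLinear⇔tree : (t : Term n) → FullLinear t ⇔ TreeOn t (allFin n)
fullLinear⇔tree {n} t = mk⇔
  (λ perm → record
    { linear = unique⇒linear t (Unique-resp-↭ (setoid (Fin n)) (↭⇒↭ₛ (↭-sym perm)) (Unique.allFin⁺ n))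
    ; unique = Unique.allFin⁺ n
    ; vars⊆ = λ _ → ∈-allFin _
    ; vars⊇ = λ x∈ → ∈leaves⇒∈ₜ t (∈-resp-↭ (↭-sym perm) x∈) })
  (λ T → ∼bag⇒↭ (unique∧set⇒bag (linear⇒unique (linear T)) (Unique.allFin⁺ n)
                   (mk⇔ (λ _ → ∈-allFin _) (∈ₜ⇒∈leaves t ∘ vars⊇ T))))

sac-converseImplication : (m : ℕ) → sac _⇐_ (suc m) (suc m ^ m)
sac-converseImplication m = term , fullLinear , injective , covers
  where
  open Digits (suc m)
  V = allFin (suc m)
  |V| : length V ≡ suc m
  |V| = length-tabulate id
  isCode : (i : Fin (suc m ^ m)) → CodeOn V (digits m i)
  isCode i = record
    { distinct = Unique.allFin⁺ (suc m)
    ; length≡ = trans |V| (cong suc (sym (length-digits m i)))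
    ; entries∈ = All.tabulate (λ _ → ∈-allFin _)
    }
  term : Fin (suc m ^ m) → Term (suc m)
  term i = decode zero V (digits m i)
  fullLinear : (i : Fin (suc m ^ m)) → FullLinear (term i)
  fullLinear i = Equivalence.from (fullLinear⇔tree (term i)) (decode-tree zero (isCode i))
  codeOfTerm : (i : Fin (suc m ^ m)) → pruferCode V (eval-extensional (term i)) m ≡ digits m i
  codeOfTerm i = subst (λ k → pruferCode V (eval-extensional (term i)) k ≡ digits m i) (length-digits m i)
                       (pruferCode-decode zero (isCode i))
  injective : (i j : Fin (suc m ^ m)) → SameOp _⇐_ (term i) (term j) → i ≡ j
  injective i j same = digits-injective m (begin
    digits m i                                           ≡⟨ sym (codeOfTerm i) ⟩
    pruferCode V (eval-extensional (term i)) m           ≡⟨ pruferCode-cong V _ _ m same ⟩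
    pruferCode V (eval-extensional (term j)) m           ≡⟨ codeOfTerm j ⟩
    digits m j                                           ∎)
    where open ≡-Reasoning
  covers : (t : Term (suc m)) → FullLinear t → ∃ λ i → SameOp _⇐_ (term i) t
  covers t fl = i , subst (λ c → SameOp _⇐_ (decode zero V c) t) (sym digits≡code) (decode-pruferCode zero m T |V|)
    where
    T = Equivalence.to (fullLinear⇔tree t) fl
    code = digits-surjective m (pruferCode V (eval-extensional t) m) (pruferCode-length m T |V|)
    i = proj₁ code
    digits≡code = proj₂ code

-- Distinct bracketings induce distinct operations

size : Term n → ℕ
size (var _) = 0
size (s · u) = suc (size s + size u)

length-leaves : (t : Term n) → length (leaves t) ≡ suc (size t)
length-leaves (var _) = refl
length-leaves (s · u) = trans (length-++ (leaves s)) (trans (cong₂ _+_ (length-leaves s) (length-leaves u)) (cong suc (+-suc (size s) (size u))))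

leaves-headVar : (t : Term n) → ∃ λ r → leaves t ≡ headVar t ∷ r
leaves-headVar (var x) = [] , refl
leaves-headVar (s · u) with leaves-headVar s
... | r , eq = r ++ leaves u , cong (_++ leaves u) eq

++-split-≡ : {A : Set} (xs xs′ : List A) {ys ys′ : List A} → length xs ≡ length xs′ → xs ++ ys ≡ xs′ ++ ys′ →
             xs ≡ xs′ × ys ≡ ys′
++-split-≡ [] [] _ eq = refl , eq
++-split-≡ (x ∷ xs) (x′ ∷ xs′) |xs| eq with ∷-injective eq
... | refl , eq′ with ++-split-≡ xs xs′ (suc-injective |xs|) eq′
... | xs≡ , ys≡ = cong (x ∷_) xs≡ , ys≡

++-split-< : {A : Set} (xs xs′ : List A) {ys ys′ : List A} → length xs < length xs′ → xs ++ ys ≡ xs′ ++ ys′ →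
             ∃₂ λ z mid → xs′ ≡ xs ++ z ∷ mid × ys ≡ z ∷ (mid ++ ys′)
++-split-< [] (z ∷ mid) _ eq = z , mid , refl , eq
++-split-< (x ∷ xs) (x′ ∷ xs′) (s≤s |xs|<) eq with ∷-injective eq
... | refl , eq′ with ++-split-< xs xs′ |xs|< eq′
... | z , mid , xs′≡ , ys≡ = z , mid , cong (x ∷_) xs′≡ , ys≡

sameOp-left : {s u s′ u′ : Term n} → Linear (s · u) → Linear (s′ · u′) → headVar u ≡ headVar u′ →
              SameOp _⇐_ (s · u) (s′ · u′) → SameOp _⇐_ s s′
sameOp-left {s = s} {u} {s′} {u′} (_ · _ ⟨ s#u ⟩) (_ · _ ⟨ s′#u′ ⟩) heads≡ same ρ = begin
  eval s ρ                ≡⟨ eval-cong s (λ x∈s → sym (≔-other ρ (Disjointₜ⇒≢ s#u x∈s (headVar∈ u)))) ⟩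
  eval s ρ′               ≡⟨ sym (eval-·-argTrue s u (eval-headTrue u (≔-same ρ (headVar u)))) ⟩
  eval (s · u) ρ′         ≡⟨ same ρ′ ⟩
  eval (s′ · u′) ρ′       ≡⟨ eval-·-argTrue s′ u′ (eval-headTrue u′ (subst (λ h → ρ′ h ≡ true) heads≡ (≔-same ρ (headVar u)))) ⟩
  eval s′ ρ′              ≡⟨ eval-cong s′ (λ x∈s′ → ≔-other ρ (λ { refl → Disjointₜ⇒≢ s′#u′ x∈s′ (headVar∈ u′) heads≡ })) ⟩
  eval s′ ρ               ∎
  where
  open ≡-Reasoning
  ρ′ = ρ [ headVar u ≔ true ]

sameOp-right : {s u u′ : Term n} → Linear (s · u) → Disjointₜ s u′ →
               SameOp _⇐_ (s · u) (s · u′) → SameOp _⇐_ u u′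
sameOp-right {s = s} {u} {u′} (lin-s · _ ⟨ s#u ⟩) s#u′ same ρ = begin
  eval u ρ                ≡⟨ eval-cong u (λ x∈u → sym (overrideOn-∉ s (falsifier s) ρ (λ x∈s → s#u x∈s x∈u))) ⟩
  eval u ρ′               ≡⟨ ⇒false-injective _ _ (begin
    (eval u ρ′ ⇒ false)          ≡⟨ cong (eval u ρ′ ⇒_) (sym s-false) ⟩
    eval (s · u) ρ′              ≡⟨ same ρ′ ⟩
    eval (s · u′) ρ′             ≡⟨ cong (eval u′ ρ′ ⇒_) s-false ⟩
    (eval u′ ρ′ ⇒ false)         ∎) ⟩
  eval u′ ρ′              ≡⟨ eval-cong u′ (λ x∈u′ → overrideOn-∉ s (falsifier s) ρ (λ x∈s → s#u′ x∈s x∈u′)) ⟩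
  eval u′ ρ               ∎
  where
  open ≡-Reasoning
  ρ′ = falsifyOn s ρ
  s-false : eval s ρ′ ≡ false
  s-false = eval-headOnlyFalse lin-s (falsifyOn-headOnlyFalse s ρ)

-- Here u′ is a proper suffix of u. With s and u′ falsified and everything else 1,
-- the head of u is 1, so t = 0 while t′ = 1.
longerLeft-notSameOp : {s u s′ u′ : Term n} {z : Fin n} {mid : List (Fin n)} →
                       Linear (s · u) → Linear (s′ · u′) → leaves u ≡ z ∷ mid ++ leaves u′ →
                       ¬ SameOp _⇐_ (s · u) (s′ · u′)
longerLeft-notSameOp {s = s} {u} {s′} {u′} {z} {mid} (lin-s · lin-u ⟨ s#u ⟩) (_ · lin-u′ ⟨ _ ⟩) u≡ same =
  false≢true (begin
    false                    ≡⟨ sym (cong₂ _⇒_ u-true s-false) ⟩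
    eval (s · u) ρ           ≡⟨ same ρ ⟩
    eval (s′ · u′) ρ         ≡⟨ cong (_⇒ eval s′ ρ) u′-false ⟩
    true                     ∎)
  where
  open ≡-Reasoning
  ρ = falsifyOn u′ (falsifier s)
  u′⊆u : ∀ {x} → x ∈ₜ u′ → x ∈ₜ u
  u′⊆u x∈u′ = ∈leaves⇒∈ₜ u (subst (_ ∈_) (sym u≡) (there (∈-++⁺ʳ mid (∈ₜ⇒∈leaves u′ x∈u′))))
  headVar-u≡z : headVar u ≡ z
  headVar-u≡z = ∷-injectiveˡ (trans (sym (proj₂ (leaves-headVar u))) u≡)
  headVar-u∉u′ : headVar u ∉ₜ u′
  headVar-u∉u′ h∈u′ with subst Unique u≡ (linear⇒unique lin-u)
  ... | z∉ ∷ _ = All.lookup z∉ (∈-++⁺ʳ mid (∈ₜ⇒∈leaves u′ h∈u′)) (sym headVar-u≡z)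
  s-false : eval s ρ ≡ false
  s-false = eval-headOnlyFalse lin-s (HeadOnlyFalse-resp
    (λ x∈s → sym (overrideOn-∉ u′ (falsifier u′) (falsifier s) (λ x∈u′ → s#u x∈s (u′⊆u x∈u′))))
    (falsifier-headOnlyFalse s))
  u-true : eval u ρ ≡ true
  u-true = eval-headTrue u (trans (overrideOn-∉ u′ (falsifier u′) (falsifier s) headVar-u∉u′)
                                  (≔-other (const true) (Disjointₜ⇒≢ s#u (headVar∈ s) (headVar∈ u) ∘ sym)))
  u′-false : eval u′ ρ ≡ false
  u′-false = eval-headOnlyFalse lin-u′ (falsifyOn-headOnlyFalse u′ (falsifier s))

sameLeaves-sameOp⇒≡ : {t t′ : Term n} → Linear t → Linear t′ → leaves t ≡ leaves t′ → SameOp _⇐_ t t′ → t ≡ t′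
sameLeaves-sameOp⇒≡ {t = var x} {var y} _ _ eq _ = cong var (∷-injectiveˡ eq)
sameLeaves-sameOp⇒≡ {t = var x} {s′ · u′} _ _ eq _ = case trans (cong length eq) (length-leaves (s′ · u′)) of λ ()
sameLeaves-sameOp⇒≡ {t = s · u} {var y} _ _ eq _ = case trans (sym (length-leaves (s · u))) (cong length eq) of λ ()
sameLeaves-sameOp⇒≡ {t = s · u} {s′ · u′} lin lin′ eq same with <-cmp (length (leaves s)) (length (leaves s′))
... | tri< |s|<|s′| _ _ = let _ , _ , _ , u≡ = ++-split-< (leaves s) (leaves s′) |s|<|s′| eq in
  ⊥-elim (longerLeft-notSameOp lin lin′ u≡ same)
... | tri> _ _ |s′|<|s| = let _ , _ , _ , u′≡ = ++-split-< (leaves s′) (leaves s) |s′|<|s| (sym eq) in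
  ⊥-elim (longerLeft-notSameOp lin′ lin u′≡ (sym ∘ same))
... | tri≈ _ |s|≡|s′| _ = cong₂ _·_ s≡s′ (sameLeaves-sameOp⇒≡ lin-u lin-u′ u≡ (sameOp-right lin s#u′ same′))
  where
  s≡ = proj₁ (++-split-≡ (leaves s) (leaves s′) |s|≡|s′| eq)
  u≡ = proj₂ (++-split-≡ (leaves s) (leaves s′) |s|≡|s′| eq)
  lin-s = proj₁ (linear-·⁻ lin)
  lin-u = proj₂ (linear-·⁻ lin)
  lin-u′ = proj₂ (linear-·⁻ lin′)
  heads≡ : headVar u ≡ headVar u′
  heads≡ = ∷-injectiveˡ (trans (sym (proj₂ (leaves-headVar u))) (trans u≡ (proj₂ (leaves-headVar u′))))
  s≡s′ : s ≡ s′
  s≡s′ = sameLeaves-sameOp⇒≡ lin-s (proj₁ (linear-·⁻ lin′)) s≡ (sameOp-left lin lin′ heads≡ same)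
  s#u′ : Disjointₜ s u′
  s#u′ = subst (λ w → Disjointₜ w u′) (sym s≡s′) (disjoint-·⁻ lin′)
  same′ : SameOp _⇐_ (s · u) (s · u′)
  same′ = subst (λ w → SameOp _⇐_ (s · u) (w · u′)) (sym s≡s′) same

-- Counting bracketings

[k+1]*[n+1]C[k+1]≡[n+1]*nCk : ∀ n k → suc k * (suc n C suc k) ≡ suc n * (n C k)
[k+1]*[n+1]C[k+1]≡[n+1]*nCk zero zero = refl
[k+1]*[n+1]C[k+1]≡[n+1]*nCk zero (suc k) = *-zeroʳ (suc (suc k))
[k+1]*[n+1]C[k+1]≡[n+1]*nCk (suc n) zero =
  trans (+-identityʳ _) (trans (nC1≡n (suc (suc n))) (sym (*-identityʳ (suc (suc n)))))
[k+1]*[n+1]C[k+1]≡[n+1]*nCk (suc n) (suc k) = begin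
  suc (suc k) * (suc (suc n) C suc (suc k))
    ≡⟨ cong (suc (suc k) *_) (sym (nCk+nC[k+1]≡[n+1]C[k+1] (suc n) (suc k))) ⟩
  suc (suc k) * (X + Y)
    ≡⟨ solve 3 (λ k X Y → (con 2 :+ k) :* (X :+ Y) := X :+ (con 1 :+ k) :* X :+ (con 2 :+ k) :* Y) refl k X Y ⟩
  X + suc k * X + suc (suc k) * Y
    ≡⟨ cong₂ (λ u v → X + u + v) ([k+1]*[n+1]C[k+1]≡[n+1]*nCk n k) ([k+1]*[n+1]C[k+1]≡[n+1]*nCk n (suc k)) ⟩
  X + suc n * (n C k) + suc n * (n C suc k)
    ≡⟨ +-assoc X (suc n * (n C k)) (suc n * (n C suc k)) ⟩
  X + (suc n * (n C k) + suc n * (n C suc k))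
    ≡⟨ cong (X +_) (sym (*-distribˡ-+ (suc n) (n C k) (n C suc k))) ⟩
  X + suc n * ((n C k) + (n C suc k))
    ≡⟨ cong (λ w → X + suc n * w) (nCk+nC[k+1]≡[n+1]C[k+1] n k) ⟩
  X + suc n * X
    ≡⟨⟩
  suc (suc n) * X ∎
  where
  open ≡-Reasoning
  X = suc n C suc k
  Y = suc n C suc (suc k)

-- forests k m is the number of lists of k bracketings, with m products in total,
-- whose leaf words concatenate to a fixed word of length m + k.
forests : ℕ → ℕ → ℕ
forests zero zero = 1
forests zero (suc m) = 0
forests (suc k) zero = 1
forests (suc k) (suc m) = forests k (suc m) + forests (suc (suc k)) m

ballot : ∀ k j → let w = suc (suc (k + (j + j))) in forests (suc k) (suc j) + (w C j) ≡ (w C suc j)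
ballot zero zero = refl
ballot zero (suc j) = begin
  forests 2 (suc j) + (suc (suc (suc j + suc j)) C suc j)
    ≡⟨ cong (λ v → forests 2 (suc j) + (v C suc j)) width≡ ⟩
  forests 2 (suc j) + (suc w C suc j)
    ≡⟨ cong (forests 2 (suc j) +_) (sym (nCk+nC[k+1]≡[n+1]C[k+1] w j)) ⟩
  forests 2 (suc j) + ((w C j) + (w C suc j))
    ≡⟨ sym (+-assoc (forests 2 (suc j)) _ _) ⟩
  forests 2 (suc j) + (w C j) + (w C suc j)
    ≡⟨ cong (_+ (w C suc j)) (ballot 1 j) ⟩
  (w C suc j) + (w C suc j)
    ≡⟨ cong ((w C suc j) +_) symmetric ⟩
  (w C suc j) + (w C suc (suc j))
    ≡⟨ nCk+nC[k+1]≡[n+1]C[k+1] w (suc j) ⟩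
  (suc w C suc (suc j))
    ≡⟨ cong (_C suc (suc j)) (sym width≡) ⟩
  (suc (suc (suc j + suc j)) C suc (suc j)) ∎
  where
  open ≡-Reasoning
  w = suc (suc (suc (j + j)))
  width≡ : suc (suc (suc j + suc j)) ≡ suc w
  width≡ = cong (λ v → suc (suc v)) (+-suc (suc j) j)
  symmetric : w C suc j ≡ w C suc (suc j)
  symmetric = trans (nCk≡nC[n∸k] (s≤s (≤-trans (m≤m+n j j) (≤-trans (n≤1+n _) (n≤1+n _)))))
                    (cong (w C_) (trans (+-∸-assoc 2 (m≤n+m j j)) (cong (2 +_) (m+n∸n≡m j j))))
ballot (suc k) zero = begin
  forests (suc k) 1 + 1 + 1   ≡⟨ cong (_+ 1) (ballot k zero) ⟩
  (w C 1) + 1                 ≡⟨ +-comm (w C 1) 1 ⟩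
  1 + (w C 1)                 ≡⟨ nCk+nC[k+1]≡[n+1]C[k+1] w 0 ⟩
  (suc w C 1)                 ∎
  where
  open ≡-Reasoning
  w = suc (suc (k + 0))
ballot (suc k) (suc j) = begin
  A + B + (suc w C suc j)
    ≡⟨ cong (A + B +_) (sym (nCk+nC[k+1]≡[n+1]C[k+1] w j)) ⟩
  A + B + (c + d)
    ≡⟨ solve 4 (λ A B c d → A :+ B :+ (c :+ d) := (A :+ d) :+ (B :+ c)) refl A B c d ⟩
  (A + d) + (B + c)
    ≡⟨ cong₂ _+_ (ballot k (suc j)) (subst (λ v → B + (v C j) ≡ (v C suc j)) width≡ (ballot (suc (suc k)) j)) ⟩
  (w C suc (suc j)) + (w C suc j)
    ≡⟨ +-comm (w C suc (suc j)) _ ⟩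
  (w C suc j) + (w C suc (suc j))
    ≡⟨ nCk+nC[k+1]≡[n+1]C[k+1] w (suc j) ⟩
  (suc w C suc (suc j)) ∎
  where
  open ≡-Reasoning
  w = suc (suc (k + (suc j + suc j)))
  A = forests (suc k) (suc (suc j))
  B = forests (suc (suc (suc k))) (suc j)
  c = w C j
  d = w C suc j
  width≡ : suc (suc (suc (suc k) + (j + j))) ≡ w
  width≡ = cong (λ v → suc (suc v))
    (solve 2 (λ k j → con 2 :+ (k :+ (j :+ j)) := k :+ (con 1 :+ (j :+ (con 1 :+ j)))) refl k j)

forests1≡catalan : ∀ m → forests 1 m ≡ catalan m
forests1≡catalan zero = refl
forests1≡catalan (suc j) = sym (trans (cong (_/ suc m) central≡) (m*n/n≡m f (suc m)))
  where
  open ≡-Reasoning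
  m = suc j
  N = 2 * m
  f = forests 1 m
  c = N C j
  c′ = N C m
  width≡ : suc (suc (j + j)) ≡ N
  width≡ = solve 1 (λ j → con 2 :+ (j :+ j) := con 2 :* (con 1 :+ j)) refl j
  ballot₀ : f + c ≡ c′
  ballot₀ = subst (λ w → f + (w C j) ≡ (w C m)) width≡ (ballot 0 j)
  absorbed : m * c′ ≡ suc m * c
  absorbed = +-cancelˡ-≡ (m * c) _ _ (begin
    m * c + m * c′     ≡⟨ sym (*-distribˡ-+ m c c′) ⟩
    m * (c + c′)       ≡⟨ cong (m *_) (nCk+nC[k+1]≡[n+1]C[k+1] N j) ⟩
    m * (suc N C m)    ≡⟨ [k+1]*[n+1]C[k+1]≡[n+1]*nCk N j ⟩
    suc N * c          ≡⟨ cong (_* c) (solve 1 (λ j → con 1 :+ con 2 :* (con 1 :+ j) := (con 1 :+ j) :+ (con 2 :+ j)) refl j) ⟩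
    (m + suc m) * c    ≡⟨ *-distribʳ-+ c m (suc m) ⟩
    m * c + suc m * c  ∎)
  central≡ : c′ ≡ f * suc m
  central≡ = +-cancelʳ-≡ (m * c′) _ _ (begin
    c′ + m * c′             ≡⟨ solve 2 (λ c′ j → c′ :+ (con 1 :+ j) :* c′ := (con 2 :+ j) :* c′) refl c′ j ⟩
    suc m * c′              ≡⟨ cong (suc m *_) (sym ballot₀) ⟩
    suc m * (f + c)         ≡⟨ *-distribˡ-+ (suc m) f c ⟩
    suc m * f + suc m * c   ≡⟨ cong₂ _+_ (*-comm (suc m) f) (sym absorbed) ⟩
    f * suc m + m * c′      ∎)

leafWord : List (Term n) → List (Fin n)
leafWord = concatMap leaves

totalSize : List (Term n) → ℕ
totalSize ts = sum (map size ts)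

mergeFirstTwo : List (Term n) → List (Term n)
mergeFirstTwo (a ∷ b ∷ ts) = (a · b) ∷ ts
mergeFirstTwo ts = ts

-- A forest starts either with a variable, or with a product a · b; splitting the latter
-- into the two trees a, b leaves one product less and one tree more.
forestsOver : (k m : ℕ) → List (Fin n) → Fin (forests k m) → List (Term n)
forestsOver zero zero _ _ = []
forestsOver (suc k) zero L _ = map var L
forestsOver (suc k) (suc m) [] _ = []
forestsOver (suc k) (suc m) (x ∷ L) i =
  [ (λ j → var x ∷ forestsOver k (suc m) L j) , (λ j → mergeFirstTwo (forestsOver (suc (suc k)) m (x ∷ L) j)) ]′
    (splitAt (forests k (suc m)) i)

leafWord-map-var : (L : List (Fin n)) → leafWord (map var L) ≡ L
leafWord-map-var [] = refl
leafWord-map-var (x ∷ L) = cong (x ∷_) (leafWord-map-var L)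

leafWord-merge : (ts : List (Term n)) → leafWord (mergeFirstTwo ts) ≡ leafWord ts
leafWord-merge [] = refl
leafWord-merge (a ∷ []) = refl
leafWord-merge (a ∷ b ∷ ts) = ++-assoc (leaves a) (leaves b) (leafWord ts)

length-merge : (ts : List (Term n)) {k : ℕ} → length ts ≡ suc (suc k) → length (mergeFirstTwo ts) ≡ suc k
length-merge (a ∷ b ∷ ts) |ts| = suc-injective |ts|

forestsOver-shape : (k m : ℕ) (L : List (Fin n)) (i : Fin (forests k m)) → length L ≡ m + k →
                    leafWord (forestsOver k m L i) ≡ L × length (forestsOver k m L i) ≡ k
forestsOver-shape zero zero [] _ _ = refl , refl
forestsOver-shape (suc k) zero L _ |L| = leafWord-map-var L , trans (length-map var L) |L|
forestsOver-shape (suc k) (suc m) (x ∷ L) i |L| =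
  [_,_] {C = λ c → Shape ([ startsWithVar , startsWithProduct ]′ c)}
    (λ j → let word , len = forestsOver-shape k (suc m) L j (suc-injective (trans |L| (cong suc (+-suc m k))))
           in cong (x ∷_) word , cong suc len)
    (λ j → let word , len = forestsOver-shape (suc (suc k)) m (x ∷ L) j (trans |L| (sym (+-suc m (suc k))))
           in trans (leafWord-merge (forestsOver (suc (suc k)) m (x ∷ L) j)) word ,
              length-merge (forestsOver (suc (suc k)) m (x ∷ L) j) len)
    (splitAt (forests k (suc m)) i)
  where
  Shape : List (Term _) → Set
  Shape ts = leafWord ts ≡ x ∷ L × length ts ≡ suc k
  startsWithVar : Fin (forests k (suc m)) → List (Term _)
  startsWithVar j = var x ∷ forestsOver k (suc m) L j
  startsWithProduct : Fin (forests (suc (suc k)) m) → List (Term _)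
  startsWithProduct j = mergeFirstTwo (forestsOver (suc (suc k)) m (x ∷ L) j)

[,]′-injective : {A B C : Set} {f : A → C} {g : B → C} →
                 (∀ {a a′} → f a ≡ f a′ → a ≡ a′) → (∀ {b b′} → g b ≡ g b′ → b ≡ b′) → (∀ {a b} → f a ≢ g b) →
                 ∀ {c c′} → [ f , g ]′ c ≡ [ f , g ]′ c′ → c ≡ c′
[,]′-injective f-inj _ _ {inj₁ a} {inj₁ a′} eq = cong inj₁ (f-inj eq)
[,]′-injective _ _ f≢g {inj₁ a} {inj₂ b} eq = ⊥-elim (f≢g eq)
[,]′-injective _ _ f≢g {inj₂ b} {inj₁ a} eq = ⊥-elim (f≢g (sym eq))
[,]′-injective _ g-inj _ {inj₂ b} {inj₂ b′} eq = cong inj₂ (g-inj eq)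

splitAt-injective : (m : ℕ) {k : ℕ} {i j : Fin (m + k)} → splitAt m i ≡ splitAt m j → i ≡ j
splitAt-injective m {k} {i} {j} eq =
  trans (sym (join-splitAt m k i)) (trans (cong (join m k) eq) (join-splitAt m k j))

merge-injective : {ts ts′ : List (Term n)} {k : ℕ} → length ts ≡ suc (suc k) → length ts′ ≡ suc (suc k) →
                  mergeFirstTwo ts ≡ mergeFirstTwo ts′ → ts ≡ ts′
merge-injective {ts = a ∷ b ∷ _} {a′ ∷ b′ ∷ _} _ _ eq with ∷-injective eq
... | refl , refl = refl

var∷≢merge : {x : Fin n} {r ts : List (Term n)} {k : ℕ} → length ts ≡ suc (suc k) → var x ∷ r ≢ mergeFirstTwo ts
var∷≢merge {ts = _ ∷ _ ∷ _} _ ()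

forestsOver-injective : (k m : ℕ) (L : List (Fin n)) {i j : Fin (forests k m)} → length L ≡ m + k →
                        forestsOver k m L i ≡ forestsOver k m L j → i ≡ j
forestsOver-injective zero zero L {zero} {zero} _ _ = refl
forestsOver-injective (suc k) zero L {zero} {zero} _ _ = refl
forestsOver-injective (suc k) (suc m) (x ∷ L) |L| eq = splitAt-injective (forests k (suc m))
  ([,]′-injective
    (λ e → forestsOver-injective k (suc m) L |L|₁ (∷-injectiveʳ e))
    (λ {b} {b′} e → forestsOver-injective (suc (suc k)) m (x ∷ L) |L|₂ (merge-injective (len b) (len b′) e))
    (λ {_} {b} → var∷≢merge {ts = forestsOver (suc (suc k)) m (x ∷ L) b} (len b))
    eq)
  where
  |L|₁ = suc-injective (trans |L| (cong suc (+-suc m k)))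
  |L|₂ = trans |L| (sym (+-suc m (suc k)))
  len : (j : Fin (forests (suc (suc k)) m)) → length (forestsOver (suc (suc k)) m (x ∷ L) j) ≡ suc (suc k)
  len j = proj₂ (forestsOver-shape (suc (suc k)) m (x ∷ L) j |L|₂)

totalSize≡0⇒vars : (ts : List (Term n)) → totalSize ts ≡ 0 → ts ≡ map var (leafWord ts)
totalSize≡0⇒vars [] _ = refl
totalSize≡0⇒vars (var x ∷ ts) size≡ = cong (var x ∷_) (totalSize≡0⇒vars ts size≡)

forestsOver-surjective : (k m : ℕ) (ts : List (Term n)) → length ts ≡ k → totalSize ts ≡ m →
                         ∃ λ i → forestsOver k m (leafWord ts) i ≡ ts
forestsOver-surjective zero zero [] _ _ = zero , refl
forestsOver-surjective (suc k) zero ts _ size≡ = zero , sym (totalSize≡0⇒vars ts size≡)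
forestsOver-surjective (suc k) (suc m) (var y ∷ ts) |ts| size≡ =
  let j , found = forestsOver-surjective k (suc m) ts (suc-injective |ts|) size≡
  in join _ _ (inj₁ j) , trans (cong [ _ , _ ]′ (splitAt-join (forests k (suc m)) _ (inj₁ j))) (cong (var y ∷_) found)
forestsOver-surjective (suc k) (suc m) ((a · b) ∷ ts) |ts| size≡ =
  subst (λ W → ∃ λ i → forestsOver (suc k) (suc m) W i ≡ (a · b) ∷ ts) (sym word≡)
    (join _ _ (inj₂ j) , trans (cong [ _ , _ ]′ (splitAt-join (forests k (suc m)) _ (inj₂ j))) (cong mergeFirstTwo found))
  where
  r = proj₁ (leaves-headVar a)
  word≡ : leafWord ((a · b) ∷ ts) ≡ headVar a ∷ (r ++ leafWord (b ∷ ts))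
  word≡ = trans (leafWord-merge (a ∷ b ∷ ts)) (cong (_++ leafWord (b ∷ ts)) (proj₂ (leaves-headVar a)))
  split = subst (λ W → ∃ λ j → forestsOver (suc (suc k)) m W j ≡ a ∷ b ∷ ts)
                (cong (_++ leafWord (b ∷ ts)) (proj₂ (leaves-headVar a)))
                (forestsOver-surjective (suc (suc k)) m (a ∷ b ∷ ts) (cong suc |ts|)
                   (trans (sym (+-assoc (size a) (size b) (totalSize ts))) (suc-injective size≡)))
  j = proj₁ split
  found = proj₂ split

theTree : (ts : List (Term n)) → length ts ≡ 1 → Term n
theTree (t ∷ []) _ = t

theTree-singleton : (ts : List (Term n)) (|ts| : length ts ≡ 1) → ts ≡ theTree ts |ts| ∷ []
theTree-singleton (t ∷ []) _ = refl

sbr-converseImplication : (m : ℕ) → sbr _⇐_ (suc m) (catalan m)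
sbr-converseImplication m = subst (sbr _⇐_ (suc m)) (forests1≡catalan m) (term , bracketing , injective , covers)
  where
  L = allFin (suc m)
  |L| : length L ≡ m + 1
  |L| = trans (length-tabulate id) (+-comm 1 m)
  shape : (i : Fin (forests 1 m)) → leafWord (forestsOver 1 m L i) ≡ L × length (forestsOver 1 m L i) ≡ 1
  shape i = forestsOver-shape 1 m L i |L|
  term : Fin (forests 1 m) → Term (suc m)
  term i = theTree (forestsOver 1 m L i) (proj₂ (shape i))
  singleton : (i : Fin (forests 1 m)) → forestsOver 1 m L i ≡ term i ∷ []
  singleton i = theTree-singleton _ (proj₂ (shape i))
  bracketing : (i : Fin (forests 1 m)) → Bracketing (term i)
  bracketing i = trans (sym (++-identityʳ (leaves (term i)))) (trans (cong leafWord (sym (singleton i))) (proj₁ (shape i)))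
  term-linear : (i : Fin (forests 1 m)) → Linear (term i)
  term-linear i = unique⇒linear (term i) (subst Unique (sym (bracketing i)) (Unique.allFin⁺ (suc m)))
  injective : (i j : Fin (forests 1 m)) → SameOp _⇐_ (term i) (term j) → i ≡ j
  injective i j same = forestsOver-injective 1 m L |L|
    (trans (singleton i) (trans (cong (_∷ []) term≡) (sym (singleton j))))
    where term≡ = sameLeaves-sameOp⇒≡ (term-linear i) (term-linear j) (trans (bracketing i) (sym (bracketing j))) same
  covers : (t : Term (suc m)) → Bracketing t → ∃ λ i → SameOp _⇐_ (term i) t
  covers t br = i , λ ρ → cong (λ w → eval w ρ) term≡t
    where
    size≡ : size t ≡ m
    size≡ = suc-injective (trans (sym (length-leaves t)) (trans (cong length br) (length-tabulate id)))
    found = subst (λ W → ∃ λ i → forestsOver 1 m W i ≡ t ∷ []) (trans (++-identityʳ (leaves t)) br)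
                  (forestsOver-surjective 1 m (t ∷ []) refl (trans (+-identityʳ (size t)) size≡))
    i = proj₁ found
    term≡t : term i ≡ t
    term≡t = ∷-injectiveˡ (trans (sym (singleton i)) (proj₂ found))

proposition6p6 : (n : ℕ) → 1 ≤ n →
    sac _⇐_ n (n ^ (n ∸ 1)) × sbr _⇐_ n (catalan (n ∸ 1))
proposition6p6 (suc m) _ = sac-converseImplication m , sbr-converseImplication m
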